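{- Let $k$ be a positive integer and $p$ a prime with $p\equiv 3\pmod 4$. Then for all integers $n\ge 0$, $$pod_3\left(p^{2k+1}n+\frac{p^{2k}-1}{4}\right)\equiv pod_3(np)\pmod 3.$$
   Context: $pod_3(n)$ denotes the number of partitions of $n$ in which no part is divisible by $3$, the odd parts are distinct, and the even parts are unrestricted (with $pod_3(0)=1$); equivalently $\sum_{n\ge0}pod_3(n)q^n=\psi(-q^3)/\psi(-q)$, where $\psi(q)=\sum_{n\ge0}q^{n(n+1)/2}$. -}

module Defs where

open import Data.Nat using (ℕ; zero; suc; _+_; _*_; _∸_; _^_; _≤ᵇ_; _%_; _/_)
open import Data.Bool using (Bool; true; false; if_then_else_)

-- pod₃ n : number of partitions of n in which no part is divisible by 3,
-- the odd parts are distinct, and the even parts are unrestricted.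

is0 : ℕ → Bool
is0 zero    = true
is0 (suc _) = false

-- podUpTo m n : number of such partitions of n using only parts ≤ m.
-- Recursion on the largest admissible part size m.
mutual
  podUpTo : ℕ → ℕ → ℕ
  podUpTo zero    n = if is0 n then 1 else 0
  podUpTo (suc m) n with (suc m) % 3 | (suc m) % 2
  ... | zero  | _     = podUpTo m n
  -- odd part size (not divisible by 3): used at most once
  ... | suc _ | suc _ = podUpTo m n + (if suc m ≤ᵇ n then podUpTo m (n ∸ suc m) else 0)
  -- even part size (not divisible by 3): any multiplicity j ≥ 0 with j*(suc m) ≤ n
  ... | suc _ | zero  = evenSum m n n

  evenSum : ℕ → ℕ → ℕ → ℕ
  evenSum m zero    n = podUpTo m n
  evenSum m (suc r) n =
    (if suc r * suc m ≤ᵇ n then podUpTo m (n ∸ suc r * suc m) else 0) + evenSum m r n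

pod₃ : ℕ → ℕ
pod₃ n = podUpTo n n

{-# OPTIONS --safe #-}
module Submission where

-- Write ψ(q) = ∑ q^T(s) with T(s) = s(s+1)/2, and replace q by -q: the generating function of
-- (-1)^n pod₃(n) is ψ(q³)/ψ(q), and ψ(q³) ≡ ψ(q)³ (mod 3), so (-1)^n pod₃(n) is congruent mod 3 to the
-- coefficient of q^n in ψ(q)², the number of pairs (a, b) with T(a) + T(b) = n, i.e. with
-- (2a+1)² + (2b+1)² = 8n + 2. All three series are eta products: ψ(q) = (q²;q²)_∞ / (q;q²)_∞ follows from a
-- finite form of Jacobi's triple product. For a prime p ≡ 3 (mod 4), p ∣ x² + y² forces p ∣ x and p ∣ y
-- (by Fermat, -1 is not a square mod p). So with m = p^(k+1) = 2r₀ + 1 the solutions for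
-- N = p^(2k+3) n + (p^(2k+2) - 1)/4 = m² np + 2T(r₀) are exactly a = r₀ + cm, b = r₀ + dm with
-- T(c) + T(d) = np; as N ≡ np (mod 2), pod₃(N) ≡ pod₃(np) (mod 3).

module Series where

  open import Data.Nat as ℕ using (ℕ; zero; suc; z≤n; s≤s)
  import Data.Nat.Properties as ℕP
  open import Data.Integer using (ℤ; +_; -1ℤ; _+_; _*_; -_; _-_)
  import Data.Integer.Properties as ℤP
  open import Data.Integer.Tactic.RingSolver using (solve-∀)
  open import Data.List using (List; []; _∷_; _++_)
  open import Relation.Binary.PropositionalEquality
  open import Function.Base using (id; _∘_)
  open import Relation.Binary.Bundles using (Setoid)
  import Relation.Binary.Reasoning.Setoid
  open import Algebra.Properties.CommutativeSemigroup ℤP.+-commutativeSemigroup using (interchange)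

  Series : Set
  Series = ℕ → ℤ

  module ≗ = Setoid (ℕ →-setoid ℤ)
  module ≗-Reasoning = Relation.Binary.Reasoning.Setoid (ℕ →-setoid ℤ)

  0ˢ : Series
  0ˢ _ = + 0

  1ˢ : Series
  1ˢ zero    = + 1
  1ˢ (suc _) = + 0

  infixl 6 _⊕_ _⊖_
  infixl 7 _·_

  _⊕_ : Series → Series → Series
  (f ⊕ g) n = f n + g n

  _⊖_ : Series → Series → Series
  (f ⊖ g) n = f n - g n

  _·_ : ℤ → Series → Series
  (c · f) n = c * f n

  infix 4 _≈[_]_

  _≈[_]_ : Series → ℕ → Series → Set
  f ≈[ M ] g = ∀ n → n ℕ.≤ M → f n ≡ g n

  ≈-refl : ∀ {f M} → f ≈[ M ] f
  ≈-refl _ _ = refl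

  ≈-sym : ∀ {f g M} → f ≈[ M ] g → g ≈[ M ] f
  ≈-sym e n n≤M = sym (e n n≤M)

  ≈-trans : ∀ {f g h M} → f ≈[ M ] g → g ≈[ M ] h → f ≈[ M ] h
  ≈-trans e e′ n n≤M = trans (e n n≤M) (e′ n n≤M)

  ≗⇒≈ : ∀ {f g M} → f ≗ g → f ≈[ M ] g
  ≗⇒≈ e n _ = e n

  ≈-weaken : ∀ {f g M K} → K ℕ.≤ M → f ≈[ M ] g → f ≈[ K ] g
  ≈-weaken K≤M e n n≤K = e n (ℕP.≤-trans n≤K K≤M)

  shift : ℕ → Series → Series
  shift zero    f         = f
  shift (suc a) f zero    = + 0
  shift (suc a) f (suc n) = shift a f n

  shift-≥ : ∀ a f {n} → a ℕ.≤ n → shift a f n ≡ f (n ℕ.∸ a)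
  shift-≥ zero    f _         = refl
  shift-≥ (suc a) f (s≤s a≤n) = shift-≥ a f a≤n

  shift-< : ∀ a f {n} → n ℕ.< a → shift a f n ≡ + 0
  shift-< (suc a) f {zero}  _         = refl
  shift-< (suc a) f {suc n} (s≤s n<a) = shift-< a f n<a

  shift-causal∸ : ∀ a M {f g} → f ≈[ M ℕ.∸ a ] g → shift a f ≈[ M ] shift a g
  shift-causal∸ zero    M       e = e
  shift-causal∸ (suc a) M       e zero    _         = refl
  shift-causal∸ (suc a) (suc M) e (suc n) (s≤s n≤M) = shift-causal∸ a M e n n≤M

  shift-causal : ∀ a M {f g} → f ≈[ M ] g → shift a f ≈[ M ] shift a g
  shift-causal a M e = shift-causal∸ a M (≈-weaken (ℕP.m∸n≤m M a) e)

  shift-delays : ∀ a M {f g} → f ≈[ M ] g → shift (suc a) f ≈[ suc M ] shift (suc a) g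
  shift-delays a M e = shift-causal∸ (suc a) (suc M) (≈-weaken (ℕP.m∸n≤m M a) e)

  shift-cong : ∀ a {f g} → f ≗ g → shift a f ≗ shift a g
  shift-cong a e n = shift-causal a n (≗⇒≈ e) n ℕP.≤-refl

  shift-pointwise₁ : ∀ a (F : ℤ → ℤ) → F (+ 0) ≡ + 0 → ∀ f → shift a (F ∘ f) ≗ F ∘ shift a f
  shift-pointwise₁ zero    F F0 f n       = refl
  shift-pointwise₁ (suc a) F F0 f zero    = sym F0
  shift-pointwise₁ (suc a) F F0 f (suc n) = shift-pointwise₁ a F F0 f n

  shift-pointwise₂ : ∀ a (F : ℤ → ℤ → ℤ) → F (+ 0) (+ 0) ≡ + 0 →
                     ∀ f g → shift a (λ n → F (f n) (g n)) ≗ λ n → F (shift a f n) (shift a g n)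
  shift-pointwise₂ zero    F F0 f g n       = refl
  shift-pointwise₂ (suc a) F F0 f g zero    = sym F0
  shift-pointwise₂ (suc a) F F0 f g (suc n) = shift-pointwise₂ a F F0 f g n

  shift-⊕ : ∀ a f g → shift a (f ⊕ g) ≗ shift a f ⊕ shift a g
  shift-⊕ a = shift-pointwise₂ a _+_ refl

  shift-⊖ : ∀ a f g → shift a (f ⊖ g) ≗ shift a f ⊖ shift a g
  shift-⊖ a = shift-pointwise₂ a _-_ refl

  shift-· : ∀ a c f → shift a (c · f) ≗ c · shift a f
  shift-· a c = shift-pointwise₁ a (c *_) (ℤP.*-zeroʳ c)

  shift-0ˢ : ∀ a → shift a 0ˢ ≗ 0ˢ
  shift-0ˢ a = shift-pointwise₁ a (λ _ → + 0) refl 0ˢ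

  shift-+ : ∀ a b f → shift a (shift b f) ≗ shift (a ℕ.+ b) f
  shift-+ zero    b f n       = refl
  shift-+ (suc a) b f zero    = refl
  shift-+ (suc a) b f (suc n) = shift-+ a b f n

  shift-comm : ∀ a b f → shift a (shift b f) ≗ shift b (shift a f)
  shift-comm a b f n = begin
    shift a (shift b f) n  ≡⟨ shift-+ a b f n ⟩
    shift (a ℕ.+ b) f n    ≡⟨ cong (λ c → shift c f n) (ℕP.+-comm a b) ⟩
    shift (b ℕ.+ a) f n    ≡⟨ shift-+ b a f n ⟨
    shift b (shift a f) n  ∎
    where open ≡-Reasoning

  geometricUpTo : ℕ → Series → ℕ → Series
  geometricUpTo b f zero    = f
  geometricUpTo b f (suc k) = f ⊕ shift (suc b) (geometricUpTo b f k)

  -- f / (1 - q^(1+b)): the partial sum with k + 1 terms is exact in degrees ≤ k.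
  geometric : ℕ → Series → Series
  geometric b f n = geometricUpTo b f n n

  geometricUpTo-stable : ∀ b f {k k′} → k ℕ.≤ k′ → geometricUpTo b f k ≈[ k ] geometricUpTo b f k′
  geometricUpTo-stable b f {zero}  {zero}   _         zero _ = refl
  geometricUpTo-stable b f {zero}  {suc k′} _         zero _ = sym (ℤP.+-identityʳ (f zero))
  geometricUpTo-stable b f {suc k} {suc k′} (s≤s k≤k′) n n≤k =
    cong (_+_ (f n)) (shift-delays b k (geometricUpTo-stable b f k≤k′) n n≤k)

  geometric-eq : ∀ b f n → geometric b f n ≡ f n + shift (suc b) (geometric b f) n
  geometric-eq b f zero    = sym (ℤP.+-identityʳ (f zero))
  geometric-eq b f (suc n) = cong (_+_ (f (suc n))) (shift-delays b n partial≈ (suc n) ℕP.≤-refl)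
    where
    partial≈ : geometricUpTo b f n ≈[ n ] geometric b f
    partial≈ i i≤n = sym (geometricUpTo-stable b f i≤n i ℕP.≤-refl)

  fixpoint-unique : ∀ b M {f f′ h g} → f ≈[ M ] f′ →
                    (∀ n → h n ≡ f n + shift (suc b) h n) →
                    (∀ n → g n ≡ f′ n + shift (suc b) g n) → h ≈[ M ] g
  fixpoint-unique b M {f} {f′} {h} {g} f≈f′ eh eg = agree M ℕP.≤-refl
    where
    agree   : ∀ K → K ℕ.≤ M → h ≈[ K ] g
    shifted : ∀ K → K ℕ.≤ M → shift (suc b) h ≈[ K ] shift (suc b) g
    agree K K≤M n n≤K = begin
      h n                       ≡⟨ eh n ⟩
      f n + shift (suc b) h n   ≡⟨ cong₂ _+_ (f≈f′ n (ℕP.≤-trans n≤K K≤M)) (shifted K K≤M n n≤K) ⟩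
      f′ n + shift (suc b) g n  ≡⟨ eg n ⟨
      g n                       ∎
      where open ≡-Reasoning
    shifted zero    _    zero _ = refl
    shifted (suc K) K<M = shift-delays b K (agree K (ℕP.<⇒≤ K<M))

  geometric-unique : ∀ b {f h} → (∀ n → h n ≡ f n + shift (suc b) h n) → h ≗ geometric b f
  geometric-unique b {f} eh n = fixpoint-unique b n {f} ≈-refl eh (geometric-eq b f) n ℕP.≤-refl

  geometric-causal : ∀ b M {f f′} → f ≈[ M ] f′ → geometric b f ≈[ M ] geometric b f′
  geometric-causal b M {f} {f′} e = fixpoint-unique b M e (geometric-eq b f) (geometric-eq b f′)

  geometric-⊕ : ∀ b f g → geometric b (f ⊕ g) ≗ geometric b f ⊕ geometric b g
  geometric-⊕ b f g = ≗.sym (geometric-unique b λ n → begin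
    G n + H n
      ≡⟨ cong₂ _+_ (geometric-eq b f n) (geometric-eq b g n) ⟩
    (f n + shift (suc b) G n) + (g n + shift (suc b) H n)
      ≡⟨ interchange (f n) _ (g n) _ ⟩
    (f n + g n) + (shift (suc b) G n + shift (suc b) H n)
      ≡⟨ cong (_+_ (f n + g n)) (shift-⊕ (suc b) G H n) ⟨
    (f n + g n) + shift (suc b) (G ⊕ H) n ∎)
    where
    open ≡-Reasoning
    G = geometric b f
    H = geometric b g

  record Linear (L : Series → Series) : Set where
    field
      causal     : ∀ M {f g} → f ≈[ M ] g → L f ≈[ M ] L g
      ⊕-hom      : ∀ f g → L (f ⊕ g) ≗ L f ⊕ L g
      ·-hom      : ∀ c f → L (c · f) ≗ c · L f
      shift-hom  : ∀ a f → L (shift a f) ≗ shift a (L f)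

    cong-≗ : ∀ {f g} → f ≗ g → L f ≗ L g
    cong-≗ e n = causal n (≗⇒≈ e) n ℕP.≤-refl

    ⊖-hom : ∀ f g → L (f ⊖ g) ≗ L f ⊖ L g
    ⊖-hom f g n = begin
      L (f ⊖ g) n               ≡⟨ cong-≗ (λ i → cong (_+_ (f i)) (sym (ℤP.-1*i≡-i (g i)))) n ⟩
      L (f ⊕ (-1ℤ · g)) n       ≡⟨ ⊕-hom f (-1ℤ · g) n ⟩
      L f n + L (-1ℤ · g) n     ≡⟨ cong (_+_ (L f n)) (·-hom -1ℤ g n) ⟩
      L f n + -1ℤ * L g n       ≡⟨ cong (_+_ (L f n)) (ℤP.-1*i≡-i (L g n)) ⟩
      L f n - L g n             ∎
      where open ≡-Reasoning

    0ˢ-hom : L 0ˢ ≗ 0ˢ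
    0ˢ-hom n = trans (·-hom (+ 0) 0ˢ n) (ℤP.*-zeroˡ (L 0ˢ n))

    geometric-comm : ∀ b f → L (geometric b f) ≗ geometric b (L f)
    geometric-comm b f = geometric-unique b λ n → begin
      L G n                                 ≡⟨ cong-≗ (geometric-eq b f) n ⟩
      L (f ⊕ shift (suc b) G) n             ≡⟨ ⊕-hom f (shift (suc b) G) n ⟩
      L f n + L (shift (suc b) G) n         ≡⟨ cong (_+_ (L f n)) (shift-hom (suc b) G n) ⟩
      L f n + shift (suc b) (L G) n         ∎
      where
      open ≡-Reasoning
      G = geometric b f

  infixl 6 _⊕ᴸ_ _⊖ᴸ_

  _⊕ᴸ_ : (L M : Series → Series) → Series → Series
  (L ⊕ᴸ M) f = L f ⊕ M f

  _⊖ᴸ_ : (L M : Series → Series) → Series → Series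
  (L ⊖ᴸ M) f = L f ⊖ M f

  private
    minus-interchange : ∀ (a b c d : ℤ) → (a + b) - (c + d) ≡ (a - c) + (b - d)
    minus-interchange = solve-∀

    *-distribˡ-minus : ∀ (c a b : ℤ) → c * (a - b) ≡ c * a - c * b
    *-distribˡ-minus = solve-∀

    *-swap : ∀ (c d a : ℤ) → c * (d * a) ≡ d * (c * a)
    *-swap = solve-∀

  id-linear : Linear id
  id-linear = record
    { causal = λ _ e → e ; ⊕-hom = λ _ _ _ → refl ; ·-hom = λ _ _ _ → refl ; shift-hom = λ _ _ _ → refl }

  scalar-linear : ∀ c → Linear (c ·_)
  scalar-linear c = record
    { causal    = λ M e n n≤M → cong (c *_) (e n n≤M)
    ; ⊕-hom     = λ f g n → ℤP.*-distribˡ-+ c (f n) (g n)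
    ; ·-hom     = λ d f n → *-swap c d (f n)
    ; shift-hom = λ a f → ≗.sym (shift-· a c f)
    }

  shift-linear : ∀ a → Linear (shift a)
  shift-linear a = record
    { causal = shift-causal a ; ⊕-hom = shift-⊕ a ; ·-hom = shift-· a ; shift-hom = λ b f → shift-comm a b f }

  geometric-linear : ∀ b → Linear (geometric b)
  geometric-linear b = record
    { causal    = geometric-causal b
    ; ⊕-hom     = geometric-⊕ b
    ; ·-hom     = λ c f → ≗.sym (Linear.geometric-comm (scalar-linear c) b f)
    ; shift-hom = λ a f → ≗.sym (Linear.geometric-comm (shift-linear a) b f)
    }

  module _ {L M : Series → Series} (L-lin : Linear L) (M-lin : Linear M) where
    private
      module L = Linear L-lin
      module M = Linear M-lin

    ∘-linear : Linear (L ∘ M)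
    ∘-linear = record
      { causal    = λ K e → L.causal K (M.causal K e)
      ; ⊕-hom     = λ f g → ≗.trans (L.cong-≗ (M.⊕-hom f g)) (L.⊕-hom (M f) (M g))
      ; ·-hom     = λ c f → ≗.trans (L.cong-≗ (M.·-hom c f)) (L.·-hom c (M f))
      ; shift-hom = λ a f → ≗.trans (L.cong-≗ (M.shift-hom a f)) (L.shift-hom a (M f))
      }

    ⊕-linear : Linear (L ⊕ᴸ M)
    ⊕-linear = record
      { causal    = λ K e n n≤K → cong₂ _+_ (L.causal K e n n≤K) (M.causal K e n n≤K)
      ; ⊕-hom     = λ f g n → trans (cong₂ _+_ (L.⊕-hom f g n) (M.⊕-hom f g n)) (interchange (L f n) _ _ _)
      ; ·-hom     = λ c f n → trans (cong₂ _+_ (L.·-hom c f n) (M.·-hom c f n)) (sym (ℤP.*-distribˡ-+ c _ _))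
      ; shift-hom = λ a f n → trans (cong₂ _+_ (L.shift-hom a f n) (M.shift-hom a f n)) (sym (shift-⊕ a (L f) (M f) n))
      }

    ⊖-linear : Linear (L ⊖ᴸ M)
    ⊖-linear = record
      { causal    = λ K e n n≤K → cong₂ _-_ (L.causal K e n n≤K) (M.causal K e n n≤K)
      ; ⊕-hom     = λ f g n → trans (cong₂ _-_ (L.⊕-hom f g n) (M.⊕-hom f g n)) (minus-interchange (L f n) _ _ _)
      ; ·-hom     = λ c f n → trans (cong₂ _-_ (L.·-hom c f n) (M.·-hom c f n)) (sym (*-distribˡ-minus c _ _))
      ; shift-hom = λ a f n → trans (cong₂ _-_ (L.shift-hom a f n) (M.shift-hom a f n)) (sym (shift-⊖ a (L f) (M f) n))
      }

  -- Apart from the single Cauchy product ψ ⋆ ψ, the argument only multiplies by 1 - q^a, 1 + q^a and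
  -- 1/(1 - q^(1+b)), so such products are kept as lists of factors acting on a series.
  data Factor : Set where
    1-q^ 1+q^ 1/1-q^1+ : ℕ → Factor

  apply : Factor → Series → Series
  apply (1-q^ a)      = id ⊖ᴸ shift a
  apply (1+q^ a)      = id ⊕ᴸ shift a
  apply (1/1-q^1+ b)  = geometric b

  apply-linear : ∀ x → Linear (apply x)
  apply-linear (1-q^ a)     = ⊖-linear id-linear (shift-linear a)
  apply-linear (1+q^ a)     = ⊕-linear id-linear (shift-linear a)
  apply-linear (1/1-q^1+ b) = geometric-linear b

  Op : Set
  Op = List Factor

  run : Op → Series → Series
  run []       = id
  run (x ∷ xs) = apply x ∘ run xs

  run-linear : ∀ xs → Linear (run xs)
  run-linear []       = id-linear
  run-linear (x ∷ xs) = ∘-linear (apply-linear x) (run-linear xs)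

  run-++ : ∀ xs ys f → run (xs ++ ys) f ≗ run xs (run ys f)
  run-++ []       ys f n = refl
  run-++ (x ∷ xs) ys f   = Linear.cong-≗ (apply-linear x) (run-++ xs ys f)

  ∑ˢ : ℕ → (ℕ → Series) → Series
  ∑ˢ zero    F = 0ˢ
  ∑ˢ (suc n) F = ∑ˢ n F ⊕ F n

  ∑ˢ-cong : ∀ n {F G : ℕ → Series} → (∀ j → F j ≗ G j) → ∑ˢ n F ≗ ∑ˢ n G
  ∑ˢ-cong zero    e i = refl
  ∑ˢ-cong (suc n) e i = cong₂ _+_ (∑ˢ-cong n e i) (e n i)

  ∑ˢ-causal : ∀ K M {F G : ℕ → Series} → (∀ j → j ℕ.< K → F j ≈[ M ] G j) → ∑ˢ K F ≈[ M ] ∑ˢ K G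
  ∑ˢ-causal zero    M e n n≤M = refl
  ∑ˢ-causal (suc K) M e n n≤M =
    cong₂ _+_ (∑ˢ-causal K M (λ j j<K → e j (ℕP.m<n⇒m<1+n j<K)) n n≤M) (e K ℕP.≤-refl n n≤M)

  ∑ˢ-⊕ : ∀ K F G → ∑ˢ K (λ j → F j ⊕ G j) ≗ ∑ˢ K F ⊕ ∑ˢ K G
  ∑ˢ-⊕ zero    F G n = refl
  ∑ˢ-⊕ (suc K) F G n = trans (cong (_+ (F K n + G K n)) (∑ˢ-⊕ K F G n)) (interchange (∑ˢ K F n) _ _ _)

  ∑ˢ-last-0ˢ : ∀ K F → F K ≗ 0ˢ → ∑ˢ (suc K) F ≗ ∑ˢ K F
  ∑ˢ-last-0ˢ K F e n = trans (cong (_+_ (∑ˢ K F n)) (e n)) (ℤP.+-identityʳ _)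

  ∑ˢ-first : ∀ K F → ∑ˢ (suc K) F ≗ F 0 ⊕ ∑ˢ K (F ∘ suc)
  ∑ˢ-first zero    F n = trans (ℤP.+-identityˡ (F 0 n)) (sym (ℤP.+-identityʳ (F 0 n)))
  ∑ˢ-first (suc K) F n = trans (cong (_+ F (suc K) n) (∑ˢ-first K F n)) (ℤP.+-assoc (F 0 n) _ (F (suc K) n))

  previous : (ℕ → Series) → ℕ → Series
  previous F zero    = 0ˢ
  previous F (suc j) = F j

  ∑ˢ-previous : ∀ K F → ∑ˢ (suc K) (previous F) ≗ ∑ˢ K F
  ∑ˢ-previous zero    F n = refl
  ∑ˢ-previous (suc K) F n = cong (_+ F K n) (∑ˢ-previous K F n)

  module Linear-properties {L : Series → Series} (L-lin : Linear L) where
    open Linear L-lin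

    apply-comm : ∀ x f → L (apply x f) ≗ apply x (L f)
    apply-comm (1-q^ a)     f = ≗.trans (⊖-hom f (shift a f)) (λ n → cong (_-_ (L f n)) (shift-hom a f n))
    apply-comm (1+q^ a)     f = ≗.trans (⊕-hom f (shift a f)) (λ n → cong (_+_ (L f n)) (shift-hom a f n))
    apply-comm (1/1-q^1+ b) f = geometric-comm b f

    run-comm : ∀ xs f → L (run xs f) ≗ run xs (L f)
    run-comm []       f n = refl
    run-comm (x ∷ xs) f   = ≗.trans (apply-comm x (run xs f)) (Linear.cong-≗ (apply-linear x) (run-comm xs f))

    ∑ˢ-hom : ∀ n F → L (∑ˢ n F) ≗ ∑ˢ n (L ∘ F)
    ∑ˢ-hom zero    F     = 0ˢ-hom
    ∑ˢ-hom (suc n) F i   = trans (⊕-hom (∑ˢ n F) (F n) i) (cong (_+ L (F n) i) (∑ˢ-hom n F i))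

  infixl 7 _⋆_

  _⋆_ : Series → Series → Series
  (f ⋆ g) zero    = f zero * g zero
  (f ⋆ g) (suc n) = f zero * g (suc n) + ((f ∘ suc) ⋆ g) n

  ⋆-coefficient-causal : ∀ n {f f′} g → f ≈[ n ] f′ → (f ⋆ g) n ≡ (f′ ⋆ g) n
  ⋆-coefficient-causal zero    g e = cong (_* g zero) (e zero z≤n)
  ⋆-coefficient-causal (suc n) g e =
    cong₂ _+_ (cong (_* g (suc n)) (e zero z≤n)) (⋆-coefficient-causal n g (λ i i≤n → e (suc i) (s≤s i≤n)))

  ⋆-⊕ : ∀ f h g → (f ⊕ h) ⋆ g ≗ f ⋆ g ⊕ h ⋆ g
  ⋆-⊕ f h g zero    = ℤP.*-distribʳ-+ (g zero) (f zero) (h zero)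
  ⋆-⊕ f h g (suc n) = trans (cong₂ _+_ (ℤP.*-distribʳ-+ (g (suc n)) (f zero) (h zero)) (⋆-⊕ (f ∘ suc) (h ∘ suc) g n))
                            (interchange (f zero * g (suc n)) _ _ _)

  ⋆-· : ∀ c f g → (c · f) ⋆ g ≗ c · (f ⋆ g)
  ⋆-· c f g zero    = ℤP.*-assoc c (f zero) (g zero)
  ⋆-· c f g (suc n) = trans (cong₂ _+_ (ℤP.*-assoc c (f zero) (g (suc n))) (⋆-· c (f ∘ suc) g n))
                            (sym (ℤP.*-distribˡ-+ c _ _))

  ⋆-shift : ∀ a f g → shift a f ⋆ g ≗ shift a (f ⋆ g)
  ⋆-shift zero    f g n       = refl
  ⋆-shift (suc a) f g zero    = ℤP.*-zeroˡ (g zero)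
  ⋆-shift (suc a) f g (suc n) = trans (cong₂ _+_ (ℤP.*-zeroˡ (g (suc n))) (⋆-shift a f g n)) (ℤP.+-identityˡ _)

  ⋆-linear : ∀ g → Linear (_⋆ g)
  ⋆-linear g = record
    { causal    = λ M e n n≤M → ⋆-coefficient-causal n g (≈-weaken n≤M e)
    ; ⊕-hom     = λ f h → ⋆-⊕ f h g
    ; ·-hom     = λ c f → ⋆-· c f g
    ; shift-hom = λ a f → ⋆-shift a f g
    }

  ⋆-identityˡ : ∀ g → 1ˢ ⋆ g ≗ g
  ⋆-identityˡ g zero    = ℤP.*-identityˡ (g zero)
  ⋆-identityˡ g (suc n) = trans (cong₂ _+_ (ℤP.*-identityˡ (g (suc n))) (Linear.0ˢ-hom (⋆-linear g) n)) (ℤP.+-identityʳ _)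

  private
    +-minus-cancel : ∀ (a b : ℤ) → (a + b) - b ≡ a
    +-minus-cancel = solve-∀

    minus-+-cancel : ∀ (a b : ℤ) → a ≡ (a - b) + b
    minus-+-cancel = solve-∀

  geometric-inverseʳ : ∀ b f → apply (1-q^ (suc b)) (geometric b f) ≗ f
  geometric-inverseʳ b f n =
    trans (cong (_- shift (suc b) (geometric b f) n) (geometric-eq b f n)) (+-minus-cancel (f n) _)

  geometric-inverseˡ : ∀ b f → geometric b (apply (1-q^ (suc b)) f) ≗ f
  geometric-inverseˡ b f = ≗.sym (geometric-unique b λ n → minus-+-cancel (f n) (shift (suc b) f n))

  1-q^-invisible : ∀ a M f → M ℕ.< a → apply (1-q^ a) f ≈[ M ] f
  1-q^-invisible a M f M<a n n≤M =
    trans (cong (_-_ (f n)) (shift-< a f (ℕP.≤-<-trans n≤M M<a))) (ℤP.+-identityʳ (f n))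

  geometric-invisible : ∀ b M f → M ℕ.≤ b → geometric b f ≈[ M ] f
  geometric-invisible b M f M≤b n n≤M =
    trans (geometric-eq b f n)
          (trans (cong (_+_ (f n)) (shift-< (suc b) (geometric b f) (s≤s (ℕP.≤-trans n≤M M≤b)))) (ℤP.+-identityʳ (f n)))

  1-q^-telescope : ∀ a c f → apply (1-q^ a) f ⊕ shift a (apply (1-q^ c) f) ≗ apply (1-q^ (a ℕ.+ c)) f
  1-q^-telescope a c f n = begin
    (f n - shift a f n) + shift a (apply (1-q^ c) f) n
      ≡⟨ cong (_+_ (f n - shift a f n)) (shift-⊖ a f (shift c f) n) ⟩
    (f n - shift a f n) + (shift a f n - shift a (shift c f) n) ≡⟨ cancel (f n) (shift a f n) _ ⟩
    f n - shift a (shift c f) n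
      ≡⟨ cong (_-_ (f n)) (shift-+ a c f n) ⟩
    f n - shift (a ℕ.+ c) f n ∎
    where
    open ≡-Reasoning
    cancel : ∀ (x y z : ℤ) → (x - y) + (y - z) ≡ x - z
    cancel = solve-∀


  geometricUpTo-∑ˢ : ∀ b f r → geometricUpTo b f r ≗ ∑ˢ (suc r) (λ j → shift (j ℕ.* suc b) f)
  geometricUpTo-∑ˢ b f zero    n = sym (ℤP.+-identityˡ (f n))
  geometricUpTo-∑ˢ b f (suc r) = begin
    f ⊕ shift (suc b) (geometricUpTo b f r)
      ≈⟨ (λ n → cong (_+_ (f n)) (shift-cong (suc b) (geometricUpTo-∑ˢ b f r) n)) ⟩
    f ⊕ shift (suc b) (∑ˢ (suc r) (λ j → shift (j ℕ.* suc b) f))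
      ≈⟨ (λ n → cong (_+_ (f n)) (Linear-properties.∑ˢ-hom (shift-linear (suc b)) (suc r) _ n)) ⟩
    f ⊕ ∑ˢ (suc r) (λ j → shift (suc b) (shift (j ℕ.* suc b) f))
      ≈⟨ (λ n → cong (_+_ (f n)) (∑ˢ-cong (suc r) (λ j → shift-+ (suc b) (j ℕ.* suc b) f) n)) ⟩
    f ⊕ ∑ˢ (suc r) (λ j → shift (suc j ℕ.* suc b) f)
      ≈⟨ ∑ˢ-first (suc r) (λ j → shift (j ℕ.* suc b) f) ⟨
    ∑ˢ (suc (suc r)) (λ j → shift (j ℕ.* suc b) f) ∎
    where open ≗-Reasoning

module EtaProducts where

  open Series
  open import Data.Nat as ℕ using (ℕ; zero; suc; s≤s)
  import Data.Nat.Properties as ℕP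
  open import Data.Integer using (ℤ; +_; -[1+_]; _+_; _-_; pred) renaming (suc to sucℤ)
  import Data.Integer.Properties as ℤP
  open import Data.List using ([]; _++_; replicate)
  open import Data.Nat.DivMod using (_%_; _/_; [m+kn]%n≡m%n; [m+n]%n≡m%n; m<n⇒m%n≡m; +-distrib-/-∣ʳ; m<n⇒m/n≡0; m*n/n≡m; m/n≡1+[m∸n]/n)
  open import Data.Nat.Divisibility using (n∣m*n)
  open import Data.Empty using (⊥-elim)
  open import Function.Base using (_∘_)
  open import Relation.Nullary using (yes; no)
  open import Relation.Binary.PropositionalEquality

  power : ℕ → ℤ → Op
  power b (+ s)    = replicate s (1-q^ (suc b))
  power b -[1+ s ] = replicate (suc s) (1/1-q^1+ b)

  ∏ : ℕ → (ℕ → Op) → Op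
  ∏ zero    h = []
  ∏ (suc K) h = h K ++ ∏ K h

  -- ∏_{b<K} (1 - q^(1+b))^(e b)
  eta : ℕ → (ℕ → ℤ) → Op
  eta K e = ∏ K λ b → power b (e b)

  power-suc : ∀ b z X → run (power b (sucℤ z)) X ≗ apply (1-q^ (suc b)) (run (power b z) X)
  power-suc b (+ t)          X n = refl
  power-suc b -[1+ zero ]    X   = ≗.sym (geometric-inverseʳ b X)
  power-suc b -[1+ suc t ]   X   = ≗.sym (geometric-inverseʳ b (run (power b -[1+ t ]) X))

  power-pred : ∀ b z X → run (power b (pred z)) X ≗ geometric b (run (power b z) X)
  power-pred b (+ zero)  X n = refl
  power-pred b (+ suc t) X   = ≗.sym (geometric-inverseˡ b (run (power b (+ t)) X))
  power-pred b -[1+ t ]  X n = refl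

  power-+ : ∀ b x y X → run (power b x) (run (power b y) X) ≗ run (power b (x + y)) X
  power-+ b (+ zero) y X n = cong (λ z → run (power b z) X n) (sym (ℤP.+-identityˡ y))
  power-+ b (+ suc s) y X = begin
    apply D (run (power b (+ s)) (run (power b y) X))  ≈⟨ Linear.cong-≗ (apply-linear D) (power-+ b (+ s) y X) ⟩
    apply D (run (power b (+ s + y)) X)                 ≈⟨ power-suc b (+ s + y) X ⟨
    run (power b (sucℤ (+ s + y))) X                    ≡⟨ cong (λ z → run (power b z) X) (ℤP.suc-+ s y) ⟨
    run (power b (+ suc s + y)) X                       ∎
    where
    open ≗-Reasoning
    D = 1-q^ (suc b)
  power-+ b -[1+ zero ] y X = begin
    geometric b (run (power b y) X)     ≈⟨ power-pred b y X ⟨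
    run (power b (pred y)) X            ≡⟨ cong (λ z → run (power b (pred z)) X) (ℤP.+-identityˡ y) ⟨
    run (power b (pred (+ 0 + y))) X    ≡⟨ cong (λ z → run (power b z) X) (ℤP.pred-+ (+ 0) y) ⟨
    run (power b (-[1+ 0 ] + y)) X      ∎
    where open ≗-Reasoning
  power-+ b -[1+ suc s ] y X = begin
    geometric b (run (power b -[1+ s ]) (run (power b y) X))
      ≈⟨ Linear.cong-≗ (geometric-linear b) (power-+ b -[1+ s ] y X) ⟩
    geometric b (run (power b (-[1+ s ] + y)) X)
      ≈⟨ power-pred b (-[1+ s ] + y) X ⟨
    run (power b (pred (-[1+ s ] + y))) X
      ≡⟨ cong (λ z → run (power b z) X) (ℤP.pred-+ -[1+ s ] y) ⟨
    run (power b (-[1+ suc s ] + y)) X ∎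
    where open ≗-Reasoning

  eta-+ : ∀ K e f X → run (eta K e) (run (eta K f) X) ≗ run (eta K (λ b → e b + f b)) X
  eta-+ zero    e f X n = refl
  eta-+ (suc K) e f X = begin
    run (eta (suc K) e) (run (eta (suc K) f) X)
      ≈⟨ run-++ (power K (e K)) (eta K e) _ ⟩
    Pe (Ee (run (eta (suc K) f) X))
      ≈⟨ Linear.cong-≗ (∘-linear (run-linear (power K (e K))) (run-linear (eta K e))) (run-++ (power K (f K)) (eta K f) X) ⟩
    Pe (Ee (Pf (Ef X)))
      ≈⟨ Linear.cong-≗ (run-linear (power K (e K))) (Linear-properties.run-comm (run-linear (eta K e)) (power K (f K)) (Ef X)) ⟩
    Pe (Pf (Ee (Ef X)))
      ≈⟨ power-+ K (e K) (f K) (Ee (Ef X)) ⟩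
    Pef (Ee (Ef X))
      ≈⟨ Linear.cong-≗ (run-linear (power K (e K + f K))) (eta-+ K e f X) ⟩
    Pef (run (eta K (λ b → e b + f b)) X)
      ≈⟨ run-++ (power K (e K + f K)) (eta K (λ b → e b + f b)) X ⟨
    run (eta (suc K) (λ b → e b + f b)) X ∎
    where
    open ≗-Reasoning
    Pe = run (power K (e K))
    Pf = run (power K (f K))
    Pef = run (power K (e K + f K))
    Ee = run (eta K e)
    Ef = run (eta K f)

  eta-cong : ∀ K {e f : ℕ → ℤ} → (∀ b → b ℕ.< K → e b ≡ f b) → eta K e ≡ eta K f
  eta-cong zero    e≡f = refl
  eta-cong (suc K) e≡f = cong₂ _++_ (cong (power K) (e≡f K ℕP.≤-refl)) (eta-cong K λ b b<K → e≡f b (ℕP.m≤n⇒m≤1+n b<K))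

  eta-0 : ∀ K X → run (eta K (λ _ → + 0)) X ≗ X
  eta-0 zero    X n = refl
  eta-0 (suc K) X   = eta-0 K X

  run-replicate-invisible : ∀ x M → (∀ Y → apply x Y ≈[ M ] Y) → ∀ s X → run (replicate s x) X ≈[ M ] X
  run-replicate-invisible x M inv zero    X = ≈-refl
  run-replicate-invisible x M inv (suc s) X = ≈-trans (inv _) (run-replicate-invisible x M inv s X)

  power-invisible : ∀ b k M X → M ℕ.≤ b → run (power b k) X ≈[ M ] X
  power-invisible b (+ s)    M X M≤b =
    run-replicate-invisible (1-q^ (suc b)) M (λ Y → 1-q^-invisible (suc b) M Y (s≤s M≤b)) s X
  power-invisible b -[1+ s ] M X M≤b =
    run-replicate-invisible (1/1-q^1+ b) M (λ Y → geometric-invisible b M Y M≤b) (suc s) X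

  eta-truncate : ∀ {K K′} e X → K ℕ.≤ K′ → run (eta K′ e) X ≈[ K ] run (eta K e) X
  eta-truncate {K} {K′} e X K≤K′ rewrite sym (ℕP.m∸n+n≡m K≤K′) = go (K′ ℕ.∸ K)
    where
    go : ∀ d → run (eta (d ℕ.+ K) e) X ≈[ K ] run (eta K e) X
    go zero    = ≈-refl
    go (suc d) = ≈-trans (≗⇒≈ (run-++ (power (d ℕ.+ K) (e (d ℕ.+ K))) (eta (d ℕ.+ K) e) X))
                         (≈-trans (power-invisible (d ℕ.+ K) (e (d ℕ.+ K)) K _ (ℕP.m≤n+m K d)) (go d))

  -- dilate d e is the exponent vector of ∏_c (1 - q^((1+d)(1+c)))^(e c).
  dilate : ℕ → (ℕ → ℤ) → ℕ → ℤ
  dilate d e b with b % suc d ℕ.≟ d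
  ... | yes _ = e (b / suc d)
  ... | no  _ = + 0

  module _ (d K : ℕ) {i : ℕ} (i≤d : i ℕ.≤ d) where
    private
      remainder : (i ℕ.+ K ℕ.* suc d) % suc d ≡ i
      remainder = trans ([m+kn]%n≡m%n i K (suc d)) (m<n⇒m%n≡m (s≤s i≤d))

      quotient : (i ℕ.+ K ℕ.* suc d) / suc d ≡ K
      quotient = trans (+-distrib-/-∣ʳ i (n∣m*n K)) (cong₂ ℕ._+_ (m<n⇒m/n≡0 (s≤s i≤d)) (m*n/n≡m K (suc d)))

    dilate-last : ∀ e → i ≡ d → dilate d e (i ℕ.+ K ℕ.* suc d) ≡ e K
    dilate-last e i≡d with (i ℕ.+ K ℕ.* suc d) % suc d ℕ.≟ d
    ... | yes _ = cong e quotient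
    ... | no ≢d = ⊥-elim (≢d (trans remainder i≡d))

    dilate-inner : ∀ e → i ℕ.< d → dilate d e (i ℕ.+ K ℕ.* suc d) ≡ + 0
    dilate-inner e i<d with (i ℕ.+ K ℕ.* suc d) % suc d ℕ.≟ d
    ... | yes ≡d = ⊥-elim (ℕP.<⇒≢ i<d (trans (sym remainder) ≡d))
    ... | no _  = refl

  eta-skip : ∀ r N e → (∀ i → i ℕ.< r → e (i ℕ.+ N) ≡ + 0) → eta (r ℕ.+ N) e ≡ eta N e
  eta-skip zero    N e zeros = refl
  eta-skip (suc r) N e zeros =
    cong₂ (λ z rest → power (r ℕ.+ N) z ++ rest) (zeros r ℕP.≤-refl) (eta-skip r N e λ i i<r → zeros i (ℕP.m<n⇒m<1+n i<r))

  eta-dilate : ∀ d K e → eta (K ℕ.* suc d) (dilate d e) ≡ ∏ K λ c → power (d ℕ.+ c ℕ.* suc d) (e c)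
  eta-dilate d zero    e = refl
  eta-dilate d (suc K) e = cong₂ (λ z rest → power (d ℕ.+ K ℕ.* suc d) z ++ rest)
    (dilate-last d K ℕP.≤-refl e refl)
    (trans (eta-skip d (K ℕ.* suc d) (dilate d e) λ i i<d → dilate-inner d K (ℕP.<⇒≤ i<d) e i<d) (eta-dilate d K e))

  private
    remainder-step : ∀ d b → (suc d ℕ.+ b) % suc d ≡ b % suc d
    remainder-step d b = trans (cong (_% suc d) (ℕP.+-comm (suc d) b)) ([m+n]%n≡m%n b (suc d))

  dilate-step : ∀ d e b → dilate d e (suc d ℕ.+ b) ≡ dilate d (e ∘ suc) b
  dilate-step d e b with (suc d ℕ.+ b) % suc d ℕ.≟ d | b % suc d ℕ.≟ d
  ... | yes _   | yes _   = cong e quotient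
    where
    quotient : (suc d ℕ.+ b) / suc d ≡ suc (b / suc d)
    quotient = trans (m/n≡1+[m∸n]/n (ℕP.m≤m+n (suc d) b)) (cong (λ x → suc (x / suc d)) (ℕP.m+n∸m≡n (suc d) b))
  ... | no  _   | no  _   = refl
  ... | yes r≡d | no  r≢d = ⊥-elim (r≢d (trans (sym (remainder-step d b)) r≡d))
  ... | no  r≢d | yes r≡d = ⊥-elim (r≢d (trans (remainder-step d b) r≡d))

  ∏-cong : ∀ K {h h′ : ℕ → Op} → (∀ b Y → run (h b) Y ≗ run (h′ b) Y) → ∀ X → run (∏ K h) X ≗ run (∏ K h′) X
  ∏-cong zero    h≗h′ X n = refl
  ∏-cong (suc K) {h} {h′} h≗h′ X = begin
    run (h K ++ ∏ K h) X      ≈⟨ run-++ (h K) (∏ K h) X ⟩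
    run (h K) (run (∏ K h) X)  ≈⟨ h≗h′ K _ ⟩
    run (h′ K) (run (∏ K h) X) ≈⟨ Linear.cong-≗ (run-linear (h′ K)) (∏-cong K h≗h′ X) ⟩
    run (h′ K) (run (∏ K h′) X) ≈⟨ run-++ (h′ K) (∏ K h′) X ⟨
    run (h′ K ++ ∏ K h′) X    ∎
    where open ≗-Reasoning

  ∏-++ : ∀ K A B X → run (∏ K λ b → A b ++ B b) X ≗ run (∏ K A) (run (∏ K B) X)
  ∏-++ zero    A B X n = refl
  ∏-++ (suc K) A B X = begin
    run ((A K ++ B K) ++ ∏ K (λ b → A b ++ B b)) X
      ≈⟨ run-++ (A K ++ B K) _ X ⟩
    run (A K ++ B K) (run (∏ K λ b → A b ++ B b) X)
      ≈⟨ run-++ (A K) (B K) _ ⟩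
    run (A K) (run (B K) (run (∏ K λ b → A b ++ B b) X))
      ≈⟨ Linear.cong-≗ (∘-linear (run-linear (A K)) (run-linear (B K))) (∏-++ K A B X) ⟩
    run (A K) (run (B K) (run (∏ K A) (run (∏ K B) X)))
      ≈⟨ Linear.cong-≗ (run-linear (A K)) (Linear-properties.run-comm (run-linear (∏ K A)) (B K) _) ⟨
    run (A K) (run (∏ K A) (run (B K) (run (∏ K B) X)))
      ≈⟨ run-++ (A K) (∏ K A) _ ⟨
    run (∏ (suc K) A) (run (B K) (run (∏ K B) X))
      ≈⟨ Linear.cong-≗ (run-linear (∏ (suc K) A)) (run-++ (B K) (∏ K B) X) ⟨
    run (∏ (suc K) A) (run (∏ (suc K) B) X) ∎
    where open ≗-Reasoning

module Congruence where

  open Series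
  open EtaProducts
  open import Data.Nat as ℕ using (ℕ; zero; suc)
  import Data.Nat.Properties as ℕP
  open import Data.Nat.Tactic.RingSolver as ℕSolver using ()
  open import Data.Integer using (ℤ; +_; -[1+_]; _+_; _*_; -_; _-_)
  import Data.Integer.Properties as ℤP
  open import Data.Integer.Divisibility.Signed using (_∣_; divides; ∣-refl; ∣m⇒∣m*n; ∣m∣n⇒∣m+n; ∣m⇒∣-m)
  open import Data.Integer.Tactic.RingSolver using (solve-∀)
  open import Data.List using (replicate)
  open import Data.Empty using (⊥-elim)
  open import Function.Base using (_∘_)
  open import Relation.Nullary using (yes; no)
  open import Relation.Binary.PropositionalEquality

  infix 4 _≡_[mod_]≤_

  record _≡_[mod_]≤_ (f g : Series) (m : ℤ) (M : ℕ) : Set where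
    constructor mk
    field get : ∀ n → n ℕ.≤ M → m ∣ f n - g n
  open _≡_[mod_]≤_

  private
    minus-trans : ∀ (a b c : ℤ) → a - c ≡ (a - b) + (b - c)
    minus-trans = solve-∀

    minus-sym : ∀ (a b : ℤ) → b - a ≡ - (a - b)
    minus-sym = solve-∀

  module _ {m : ℤ} {M : ℕ} where

    ≈⇒≡mod : ∀ {f g} → f ≈[ M ] g → f ≡ g [mod m ]≤ M
    ≈⇒≡mod {f} e = mk λ n n≤M → divides (+ 0) (trans (cong (_-_ (f n)) (sym (e n n≤M))) (ℤP.+-inverseʳ (f n)))

    ≗⇒≡mod : ∀ {f g} → f ≗ g → f ≡ g [mod m ]≤ M
    ≗⇒≡mod e = ≈⇒≡mod (≗⇒≈ e)

    ≡mod-sym : ∀ {f g} → f ≡ g [mod m ]≤ M → g ≡ f [mod m ]≤ M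
    ≡mod-sym {f} {g} (mk d) = mk λ n n≤M → subst (m ∣_) (sym (minus-sym (f n) (g n))) (∣m⇒∣-m (d n n≤M))

    ≡mod-trans : ∀ {f g h} → f ≡ g [mod m ]≤ M → g ≡ h [mod m ]≤ M → f ≡ h [mod m ]≤ M
    ≡mod-trans {f} {g} {h} (mk d) (mk d′) =
      mk λ n n≤M → subst (m ∣_) (sym (minus-trans (f n) (g n) (h n))) (∣m∣n⇒∣m+n (d n n≤M) (d′ n n≤M))

    -- A congruence up to degree M factors as f - g ≈ m·h up to degree M, and L(m·h) = m·L h.
    Linear-preserves-≡mod : ∀ {L} → Linear L → ∀ {f g} → f ≡ g [mod m ]≤ M → L f ≡ L g [mod m ]≤ M
    Linear-preserves-≡mod {L} L-lin {f} {g} (mk d) = mk λ n n≤M →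
      subst (m ∣_) (difference n n≤M) (∣m⇒∣m*n (L h n) ∣-refl)
      where
      open Linear L-lin
      h : Series
      h n with n ℕP.≤? M
      ... | yes n≤M = _∣_.quotient (d n n≤M)
      ... | no  _   = + 0
      f⊖g≈m·h : f ⊖ g ≈[ M ] m · h
      f⊖g≈m·h n n≤M with n ℕP.≤? M
      ... | yes n≤M′ = trans (_∣_.equality (d n n≤M′)) (ℤP.*-comm _ m)
      ... | no  n≰M  = ⊥-elim (n≰M n≤M)
      difference : ∀ n → n ℕ.≤ M → m * L h n ≡ L f n - L g n
      difference n n≤M = begin
        m * L h n       ≡⟨ ·-hom m h n ⟨
        L (m · h) n     ≡⟨ causal M f⊖g≈m·h n n≤M ⟨
        L (f ⊖ g) n     ≡⟨ ⊖-hom f g n ⟩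
        L f n - L g n   ∎
        where open ≡-Reasoning

  private
    cube-expansion : ∀ (A B C D : ℤ) → ((A - B) - (B - C)) - ((B - C) - (C - D)) - (A - D) ≡ (C - B) * + 3
    cube-expansion = solve-∀

    triple-index : ∀ a → a ℕ.+ (a ℕ.+ a) ≡ a ℕ.* 3
    triple-index = ℕSolver.solve-∀

  frobenius-1-q^ : ∀ a M f → run (replicate 3 (1-q^ a)) f ≡ apply (1-q^ (a ℕ.* 3)) f [mod + 3 ]≤ M
  frobenius-1-q^ a M f = mk λ n _ → divides (C n - B n) (trans (difference n) (cube-expansion (f n) (B n) (C n) (D n)))
    where
    S = shift a
    B = S f
    C = S B
    D = S C
    Δ : Series → Series
    Δ = apply (1-q^ a)
    S-Δ : ∀ g n → S (Δ g) n ≡ S g n - S (S g) n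
    S-Δ g = shift-⊖ a g (S g)
    S³ : ∀ n → shift (a ℕ.* 3) f n ≡ D n
    S³ n = trans (cong (λ c → shift c f n) (sym (triple-index a)))
                 (sym (trans (shift-cong a (shift-+ a a f) n) (shift-+ a (a ℕ.+ a) f n)))
    Δ²f : ∀ n → Δ (Δ f) n ≡ (f n - B n) - (B n - C n)
    Δ²f n = cong (_-_ (f n - B n)) (S-Δ f n)
    SΔ²f : ∀ n → S (Δ (Δ f)) n ≡ (B n - C n) - (C n - D n)
    SΔ²f n = trans (S-Δ (Δ f) n) (cong₂ _-_ (S-Δ f n) (trans (shift-cong a (S-Δ f) n) (S-Δ B n)))
    difference : ∀ n → Δ (Δ (Δ f)) n - (f n - shift (a ℕ.* 3) f n)
                     ≡ ((f n - B n) - (B n - C n)) - ((B n - C n) - (C n - D n)) - (f n - D n)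
    difference n = cong₂ _-_ (cong₂ _-_ (Δ²f n) (SΔ²f n)) (cong (_-_ (f n)) (S³ n))

  frobenius-geometric : ∀ b M f → run (replicate 3 (1/1-q^1+ b)) f ≡ geometric (2 ℕ.+ b ℕ.* 3) f [mod + 3 ]≤ M
  frobenius-geometric b M f =
    ≡mod-trans (≗⇒≡mod (≗.sym (geometric-inverseˡ b′ g)))
      (≡mod-trans (Linear-preserves-≡mod (geometric-linear b′) Δ′g≡Δ′h) (≗⇒≡mod (geometric-inverseˡ b′ h)))
    where
    b′ = 2 ℕ.+ b ℕ.* 3
    Δ = apply (1-q^ (suc b))
    Δ′ = apply (1-q^ (suc b′))
    g = run (replicate 3 (1/1-q^1+ b)) f
    h = geometric b′ f
    Δ³g≗f : Δ (Δ (Δ g)) ≗ f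
    Δ³g≗f = ≗.trans (Linear.cong-≗ (apply-linear (1-q^ (suc b))) (Linear.cong-≗ (apply-linear (1-q^ (suc b)))
                       (geometric-inverseʳ b (geometric b (geometric b f)))))
             (≗.trans (Linear.cong-≗ (apply-linear (1-q^ (suc b))) (geometric-inverseʳ b (geometric b f)))
                      (geometric-inverseʳ b f))
    Δ′g≡Δ′h : Δ′ g ≡ Δ′ h [mod + 3 ]≤ M
    Δ′g≡Δ′h = ≡mod-trans (≡mod-sym (frobenius-1-q^ (suc b) M g))
                (≗⇒≡mod (≗.trans Δ³g≗f (≗.sym (geometric-inverseʳ b′ f))))

  -- 3k, defined by cases so that power b (triple k) unfolds three factors at a time.
  triple : ℤ → ℤ
  triple (+ s)    = + (s ℕ.* 3)
  triple -[1+ s ] = -[1+ suc (suc (s ℕ.* 3)) ]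

  power-frobenius : ∀ b k M X → run (power b (triple k)) X ≡ run (power (2 ℕ.+ b ℕ.* 3) k) X [mod + 3 ]≤ M
  power-frobenius b (+ zero) M X = ≈⇒≡mod ≈-refl
  power-frobenius b (+ suc s) M X =
    ≡mod-trans (frobenius-1-q^ (suc b) M (run (power b (triple (+ s))) X))
               (Linear-preserves-≡mod (apply-linear (1-q^ (3 ℕ.+ b ℕ.* 3))) (power-frobenius b (+ s) M X))
  power-frobenius b -[1+ zero ]  M X = frobenius-geometric b M X
  power-frobenius b -[1+ suc s ] M X =
    ≡mod-trans (frobenius-geometric b M (run (power b (triple -[1+ s ])) X))
               (Linear-preserves-≡mod (geometric-linear (2 ℕ.+ b ℕ.* 3)) (power-frobenius b -[1+ s ] M X))

  ∏-frobenius : ∀ K e M X → run (eta K (triple ∘ e)) X ≡ run (∏ K λ c → power (2 ℕ.+ c ℕ.* 3) (e c)) X [mod + 3 ]≤ M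
  ∏-frobenius zero    e M X = ≈⇒≡mod ≈-refl
  ∏-frobenius (suc K) e M X =
    ≡mod-trans (≗⇒≡mod (run-++ (power K (triple (e K))) (eta K (triple ∘ e)) X))
    (≡mod-trans (power-frobenius K (e K) M _)
    (≡mod-trans (Linear-preserves-≡mod (run-linear (power (2 ℕ.+ K ℕ.* 3) (e K))) (∏-frobenius K e M X))
                (≗⇒≡mod (≗.sym (run-++ (power (2 ℕ.+ K ℕ.* 3) (e K)) _ X)))))

  eta-frobenius : ∀ M e X → run (eta M (triple ∘ e)) X ≡ run (eta M (dilate 2 e)) X [mod + 3 ]≤ M
  eta-frobenius M e X =
    ≡mod-trans (∏-frobenius M e M X)
      (≈⇒≡mod (≈-trans (≗⇒≈ λ n → cong (λ xs → run xs X n) (sym (eta-dilate 2 M e)))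
                       (eta-truncate (dilate 2 e) X (ℕP.m≤m*n M 3))))

module GaussianBinomials where

  open Series
  open EtaProducts
  open import Data.Nat as ℕ using (ℕ; zero; suc; s≤s)
  import Data.Nat.Properties as ℕP
  open import Data.Integer using (ℤ; +_; _+_; _-_)
  import Data.Integer.Properties as ℤP
  open import Data.Integer.Tactic.RingSolver using (solve-∀)
  open import Data.List using ([]; _∷_)
  open import Data.Sum using (inj₁; inj₂)
  open import Relation.Binary.Definitions using (tri<; tri≈; tri>)
  open import Relation.Binary.PropositionalEquality

  qBinomial : ℕ → ℕ → Series
  qBinomial zero    zero    = 1ˢ
  qBinomial zero    (suc j) = 0ˢ
  qBinomial (suc N) zero    = 1ˢ
  qBinomial (suc N) (suc j) = qBinomial N j ⊕ shift (suc j) (qBinomial N (suc j))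

  qBinomial-0 : ∀ N → qBinomial N 0 ≗ 1ˢ
  qBinomial-0 zero    n = refl
  qBinomial-0 (suc N) n = refl

  qBinomial-> : ∀ N j → N ℕ.< j → qBinomial N j ≗ 0ˢ
  qBinomial-> zero    (suc j) _         n = refl
  qBinomial-> (suc N) (suc j) (s≤s N<j) n = begin
    qBinomial N j n + shift (suc j) (qBinomial N (suc j)) n
      ≡⟨ cong₂ _+_ (qBinomial-> N j N<j n) (shift-cong (suc j) (qBinomial-> N (suc j) (ℕP.m<n⇒m<1+n N<j)) n) ⟩
    + 0 + shift (suc j) 0ˢ n
      ≡⟨ trans (ℤP.+-identityˡ _) (shift-0ˢ (suc j) n) ⟩
    + 0 ∎
    where open ≡-Reasoning

  qBinomial-diag : ∀ N → qBinomial N N ≗ 1ˢ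
  qBinomial-diag zero    n = refl
  qBinomial-diag (suc N) n = begin
    qBinomial N N n + shift (suc N) (qBinomial N (suc N)) n
      ≡⟨ cong₂ _+_ (qBinomial-diag N n) (shift-cong (suc N) (qBinomial-> N (suc N) ℕP.≤-refl) n) ⟩
    1ˢ n + shift (suc N) 0ˢ n
      ≡⟨ cong (_+_ (1ˢ n)) (shift-0ˢ (suc N) n) ⟩
    1ˢ n + + 0
      ≡⟨ ℤP.+-identityʳ (1ˢ n) ⟩
    1ˢ n ∎
    where open ≡-Reasoning

  Δ : ℕ → Series → Series
  Δ a = apply (1-q^ a)

  Δ-0 : ∀ f → Δ 0 f ≗ 0ˢ
  Δ-0 f n = ℤP.+-inverseʳ (f n)

  Δ-0ˢ : ∀ a → Δ a 0ˢ ≗ 0ˢ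
  Δ-0ˢ a = Linear.0ˢ-hom (apply-linear (1-q^ a))

  Δ-pascal : ∀ a c f g → Δ a (f ⊕ shift c g) ≗ Δ a f ⊕ shift c (Δ a g)
  Δ-pascal a c f g = ≗.trans (⊕-hom f (shift c g)) (λ n → cong (_+_ (Δ a f n)) (shift-hom c g n))
    where open Linear (apply-linear (1-q^ a))

  qBinomial-ratio : ∀ N j → Δ (suc j) (qBinomial N (suc j)) ≗ Δ (N ℕ.∸ j) (qBinomial N j)
  qBinomial-ratio zero zero n = trans (Δ-0ˢ 1 n) (sym (Δ-0 1ˢ n))
  qBinomial-ratio zero (suc j) n = trans (Δ-0ˢ (suc (suc j)) n) (sym (Δ-0ˢ 0 n))
  qBinomial-ratio (suc N) zero = begin
    Δ 1 (qBinomial N 0 ⊕ shift 1 (qBinomial N 1))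
      ≈⟨ Δ-pascal 1 1 (qBinomial N 0) (qBinomial N 1) ⟩
    Δ 1 (qBinomial N 0) ⊕ shift 1 (Δ 1 (qBinomial N 1))
      ≈⟨ (λ n → cong (_+_ (Δ 1 (qBinomial N 0) n)) (shift-cong 1 (qBinomial-ratio N 0) n)) ⟩
    Δ 1 (qBinomial N 0) ⊕ shift 1 (Δ N (qBinomial N 0))
      ≈⟨ 1-q^-telescope 1 N (qBinomial N 0) ⟩
    Δ (suc N) (qBinomial N 0)
      ≈⟨ Linear.cong-≗ (apply-linear (1-q^ (suc N))) (qBinomial-0 N) ⟩
    Δ (suc N) 1ˢ ∎
    where open ≗-Reasoning
  qBinomial-ratio (suc N) (suc j) with ℕP.<-cmp j N
  ... | tri< j<N _ _ = ≗.trans lhs (≗.sym rhs)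
    where
    open ≗-Reasoning
    X = qBinomial N (suc j)
    lhs : Δ (suc (suc j)) (qBinomial (suc N) (suc (suc j))) ≗ Δ (suc N) X
    lhs = begin
      Δ (suc (suc j)) (X ⊕ shift (suc (suc j)) (qBinomial N (suc (suc j))))
        ≈⟨ Δ-pascal (suc (suc j)) (suc (suc j)) X (qBinomial N (suc (suc j))) ⟩
      Δ (suc (suc j)) X ⊕ shift (suc (suc j)) (Δ (suc (suc j)) (qBinomial N (suc (suc j))))
        ≈⟨ (λ n → cong (_+_ (Δ (suc (suc j)) X n)) (shift-cong (suc (suc j)) (qBinomial-ratio N (suc j)) n)) ⟩
      Δ (suc (suc j)) X ⊕ shift (suc (suc j)) (Δ (N ℕ.∸ suc j) X)
        ≈⟨ 1-q^-telescope (suc (suc j)) (N ℕ.∸ suc j) X ⟩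
      Δ (suc (suc j) ℕ.+ (N ℕ.∸ suc j)) X
        ≡⟨ cong (λ a → Δ a X) (cong suc (ℕP.m+[n∸m]≡n j<N)) ⟩
      Δ (suc N) X ∎
    rhs : Δ (N ℕ.∸ j) (qBinomial (suc N) (suc j)) ≗ Δ (suc N) X
    rhs = begin
      Δ (N ℕ.∸ j) (qBinomial N j ⊕ shift (suc j) X)
        ≈⟨ Δ-pascal (N ℕ.∸ j) (suc j) (qBinomial N j) X ⟩
      Δ (N ℕ.∸ j) (qBinomial N j) ⊕ shift (suc j) (Δ (N ℕ.∸ j) X)
        ≈⟨ (λ n → cong (_+ shift (suc j) (Δ (N ℕ.∸ j) X) n) (qBinomial-ratio N j n)) ⟨
      Δ (suc j) X ⊕ shift (suc j) (Δ (N ℕ.∸ j) X)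
        ≈⟨ 1-q^-telescope (suc j) (N ℕ.∸ j) X ⟩
      Δ (suc j ℕ.+ (N ℕ.∸ j)) X
        ≡⟨ cong (λ a → Δ a X) (cong suc (ℕP.m+[n∸m]≡n (ℕP.<⇒≤ j<N))) ⟩
      Δ (suc N) X ∎
  ... | tri≈ _ refl _ = begin
    Δ (suc (suc j)) (qBinomial (suc j) (suc (suc j)))
      ≈⟨ Linear.cong-≗ (apply-linear (1-q^ (suc (suc j)))) (qBinomial-> (suc j) (suc (suc j)) ℕP.≤-refl) ⟩
    Δ (suc (suc j)) 0ˢ
      ≈⟨ Δ-0ˢ (suc (suc j)) ⟩
    0ˢ
      ≈⟨ Δ-0 (qBinomial (suc j) (suc j)) ⟨
    Δ 0 (qBinomial (suc j) (suc j))
      ≡⟨ cong (λ a → Δ a (qBinomial (suc j) (suc j))) (ℕP.n∸n≡0 j) ⟨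
    Δ (j ℕ.∸ j) (qBinomial (suc j) (suc j)) ∎
    where open ≗-Reasoning
  ... | tri> _ _ N<j = begin
    Δ (suc (suc j)) (qBinomial (suc N) (suc (suc j)))
      ≈⟨ Linear.cong-≗ (apply-linear (1-q^ (suc (suc j)))) (qBinomial-> (suc N) (suc (suc j)) (s≤s (ℕP.m<n⇒m<1+n N<j))) ⟩
    Δ (suc (suc j)) 0ˢ
      ≈⟨ Δ-0ˢ (suc (suc j)) ⟩
    0ˢ
      ≈⟨ Δ-0ˢ (N ℕ.∸ j) ⟨
    Δ (N ℕ.∸ j) 0ˢ
      ≈⟨ Linear.cong-≗ (apply-linear (1-q^ (N ℕ.∸ j))) (qBinomial-> (suc N) (suc j) (s≤s N<j)) ⟨
    Δ (N ℕ.∸ j) (qBinomial (suc N) (suc j)) ∎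
    where open ≗-Reasoning

  private
    swap-sides : ∀ {x sx y sy : ℤ} → x - sx ≡ y - sy → y + sx ≡ sy + x
    swap-sides {x} {sx} {y} {sy} e = begin
      y + sx                            ≡⟨ expand x sx y sy ⟩
      sy + x + ((y - sy) - (x - sx))    ≡⟨ cong (λ d → sy + x + (d - (x - sx))) e ⟨
      sy + x + ((x - sx) - (x - sx))    ≡⟨ cong (_+_ (sy + x)) (ℤP.+-inverseʳ (x - sx)) ⟩
      sy + x + + 0                      ≡⟨ ℤP.+-identityʳ (sy + x) ⟩
      sy + x                            ∎
      where
      open ≡-Reasoning
      expand : ∀ x sx y sy → y + sx ≡ sy + x + ((y - sy) - (x - sx))
      expand = solve-∀

  qBinomial-pascal′ : ∀ N j → qBinomial (suc N) (suc j) ≗ shift (N ℕ.∸ j) (qBinomial N j) ⊕ qBinomial N (suc j)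
  qBinomial-pascal′ N j n = swap-sides {x = qBinomial N (suc j) n} {y = qBinomial N j n} (qBinomial-ratio N j n)

  qBinomial-sym : ∀ N j → j ℕ.≤ N → qBinomial N j ≗ qBinomial N (N ℕ.∸ j)
  qBinomial-sym zero    zero    _ n = refl
  qBinomial-sym (suc N) zero    _ n = sym (qBinomial-diag (suc N) n)
  qBinomial-sym (suc N) (suc j) (s≤s j≤N) with ℕP.m≤n⇒m<n∨m≡n j≤N
  ... | inj₂ refl = ≗.trans (qBinomial-diag (suc j)) λ n → cong (λ i → qBinomial (suc j) i n) (sym (ℕP.n∸n≡0 j))
  ... | inj₁ j<N = begin
    qBinomial (suc N) (suc j)
      ≈⟨ qBinomial-pascal′ N j ⟩
    shift (N ℕ.∸ j) (qBinomial N j) ⊕ qBinomial N (suc j)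
      ≈⟨ (λ n → cong₂ _+_ (shift-cong (N ℕ.∸ j) (qBinomial-sym N j j≤N) n) (qBinomial-sym N (suc j) j<N n)) ⟩
    shift (N ℕ.∸ j) (qBinomial N (N ℕ.∸ j)) ⊕ qBinomial N (N ℕ.∸ suc j)
      ≡⟨ cong (λ i → shift i (qBinomial N i) ⊕ qBinomial N (N ℕ.∸ suc j)) N∸j ⟩
    shift (suc i) (qBinomial N (suc i)) ⊕ qBinomial N i
      ≈⟨ (λ n → ℤP.+-comm (shift (suc i) (qBinomial N (suc i)) n) (qBinomial N i n)) ⟩
    qBinomial (suc N) (suc i)
      ≡⟨ cong (qBinomial (suc N)) N∸j ⟨
    qBinomial (suc N) (N ℕ.∸ j) ∎
    where
    open ≗-Reasoning
    i = N ℕ.∸ suc j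
    N∸j : N ℕ.∸ j ≡ suc i
    N∸j = ℕP.+-∸-assoc 1 j<N

  qPochhammer : ℕ → Op
  qPochhammer K = eta K λ _ → + 1

  falling : ℕ → ℕ → Op
  falling N zero    = []
  falling N (suc j) = 1-q^ (N ℕ.∸ j) ∷ falling N j

  qPochhammer-qBinomial : ∀ N j → run (qPochhammer j) (qBinomial N j) ≗ run (falling N j) 1ˢ
  qPochhammer-qBinomial N zero    = qBinomial-0 N
  qPochhammer-qBinomial N (suc j) = begin
    Δ (suc j) (run (qPochhammer j) (qBinomial N (suc j)))
      ≈⟨ run-comm (qPochhammer j) (1-q^ (suc j)) (qBinomial N (suc j)) ⟨
    run (qPochhammer j) (Δ (suc j) (qBinomial N (suc j)))
      ≈⟨ Linear.cong-≗ (run-linear (qPochhammer j)) (qBinomial-ratio N j) ⟩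
    run (qPochhammer j) (Δ (N ℕ.∸ j) (qBinomial N j))
      ≈⟨ run-comm (qPochhammer j) (1-q^ (N ℕ.∸ j)) (qBinomial N j) ⟩
    Δ (N ℕ.∸ j) (run (qPochhammer j) (qBinomial N j))
      ≈⟨ Linear.cong-≗ (apply-linear (1-q^ (N ℕ.∸ j))) (qPochhammer-qBinomial N j) ⟩
    Δ (N ℕ.∸ j) (run (falling N j) 1ˢ) ∎
    where
    open ≗-Reasoning
    run-comm : ∀ xs x f → run xs (apply x f) ≗ apply x (run xs f)
    run-comm xs = Linear-properties.apply-comm (run-linear xs)

  falling-invisible : ∀ N j → j ℕ.≤ N → run (falling N j) 1ˢ ≈[ N ℕ.∸ j ] 1ˢ
  falling-invisible N zero    _   = ≈-refl
  falling-invisible N (suc j) j<N =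
    ≈-trans (1-q^-invisible (N ℕ.∸ j) (N ℕ.∸ suc j) _ (ℕP.∸-monoʳ-< (ℕP.n<1+n j) j<N))
            (≈-weaken (ℕP.∸-monoʳ-≤ N (ℕP.n≤1+n j)) (falling-invisible N j (ℕP.<⇒≤ j<N)))

  qPochhammer-qBinomial-invisible : ∀ N K j → j ℕ.≤ K → j ℕ.≤ N ℕ.∸ j → run (qPochhammer K) (qBinomial N j) ≈[ j ] 1ˢ
  qPochhammer-qBinomial-invisible N K j j≤K j≤N∸j =
    ≈-trans (eta-truncate (λ _ → + 1) (qBinomial N j) j≤K)
    (≈-trans (≗⇒≈ (qPochhammer-qBinomial N j))
             (≈-weaken j≤N∸j (falling-invisible N j (ℕP.≤-trans j≤N∸j (ℕP.m∸n≤m N j)))))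

module TripleProduct where

  open Series
  open EtaProducts
  open GaussianBinomials
  open import Data.Nat as ℕ using (ℕ; zero; suc; z≤n; s≤s)
  import Data.Nat.Properties as ℕP
  open import Data.Nat.Tactic.RingSolver as ℕSolver using ()
  open import Data.Integer using (ℤ; +_; -1ℤ; _+_; _*_)
  import Data.Integer.Properties as ℤP
  open import Data.Integer.Tactic.RingSolver using (solve-∀)
  open import Data.List using ([]; _∷_; _++_)
  open import Function.Base using (_∘_)
  open import Relation.Nullary using (yes; no)
  open import Relation.Binary.PropositionalEquality

  tri : ℕ → ℕ
  tri zero    = zero
  tri (suc s) = suc s ℕ.+ tri s

  -- triDiff j n = T(j - n) for the triangular numbers T(k) = k(k+1)/2 extended to k ∈ ℤ,
  -- so that T(-1-k) = T(k).
  triDiff : ℕ → ℕ → ℕ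
  triDiff j       zero    = tri j
  triDiff zero    (suc n) = tri n
  triDiff (suc j) (suc n) = triDiff j n

  triDiff-step : ∀ j n → triDiff j n ℕ.+ suc j ≡ n ℕ.+ triDiff (suc j) n
  triDiff-step j       zero          = ℕP.+-comm (tri j) (suc j)
  triDiff-step zero    (suc zero)    = refl
  triDiff-step zero    (suc (suc n)) = ℕP.+-comm (suc n ℕ.+ tri n) 1
  triDiff-step (suc j) (suc n)       = trans (ℕP.+-suc (triDiff j n) (suc j)) (cong suc (triDiff-step j n))

  triDiff-step′ : ∀ j n m → j ℕ.≤ m ℕ.+ n → triDiff (suc j) n ℕ.+ (m ℕ.+ n ℕ.∸ j) ≡ suc m ℕ.+ triDiff j n
  triDiff-step′ j n m j≤m+n = ℕP.+-cancelˡ-≡ n _ _ (begin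
    n ℕ.+ (triDiff (suc j) n ℕ.+ (m ℕ.+ n ℕ.∸ j))  ≡⟨ ℕP.+-assoc n _ _ ⟨
    n ℕ.+ triDiff (suc j) n ℕ.+ (m ℕ.+ n ℕ.∸ j)    ≡⟨ cong (ℕ._+ (m ℕ.+ n ℕ.∸ j)) (triDiff-step j n) ⟨
    triDiff j n ℕ.+ suc j ℕ.+ (m ℕ.+ n ℕ.∸ j)      ≡⟨ ℕP.+-assoc (triDiff j n) (suc j) _ ⟩
    triDiff j n ℕ.+ suc (j ℕ.+ (m ℕ.+ n ℕ.∸ j))    ≡⟨ cong (λ x → triDiff j n ℕ.+ suc x) (ℕP.m+[n∸m]≡n j≤m+n) ⟩
    triDiff j n ℕ.+ suc (m ℕ.+ n)                   ≡⟨ rearrange n m (triDiff j n) ⟩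
    n ℕ.+ (suc m ℕ.+ triDiff j n)                   ∎)
    where
    open ≡-Reasoning
    rearrange : ∀ n m t → t ℕ.+ suc (m ℕ.+ n) ≡ n ℕ.+ (suc m ℕ.+ t)
    rearrange = ℕSolver.solve-∀

  triDiff-0 : ∀ n → n ℕ.+ triDiff 0 n ≡ tri n
  triDiff-0 zero    = refl
  triDiff-0 (suc n) = refl

  triDiff-+ : ∀ n k → triDiff (n ℕ.+ k) n ≡ tri k
  triDiff-+ zero    k = refl
  triDiff-+ (suc n) k = triDiff-+ n k

  triDiff-≤ : ∀ j n → j ℕ.≤ n → triDiff j (suc n) ≡ tri (n ℕ.∸ j)
  triDiff-≤ zero    n       _         = refl
  triDiff-≤ (suc j) (suc n) (s≤s j≤n) = triDiff-≤ j n j≤n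

  n≤tri : ∀ n → n ℕ.≤ tri n
  n≤tri zero    = z≤n
  n≤tri (suc n) = ℕP.m≤m+n (suc n) (tri n)

  plusPochhammer : ℕ → ℕ → Op
  plusPochhammer c m = ∏ m λ b → 1+q^ (c ℕ.+ b) ∷ []

  ∑ˢ-1+q^ : ∀ L a {A B S} → ∑ˢ L A ≗ S → ∑ˢ L B ≗ S → ∑ˢ L (λ j → A j ⊕ shift a (B j)) ≗ apply (1+q^ a) S
  ∑ˢ-1+q^ L a {A} {B} {S} ∑A ∑B = begin
    ∑ˢ L (λ j → A j ⊕ shift a (B j))
      ≈⟨ ∑ˢ-⊕ L A (shift a ∘ B) ⟩
    ∑ˢ L A ⊕ ∑ˢ L (shift a ∘ B)
      ≈⟨ (λ n → cong (_+_ (∑ˢ L A n)) (Linear-properties.∑ˢ-hom (shift-linear a) L B n)) ⟨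
    ∑ˢ L A ⊕ shift a (∑ˢ L B)
      ≈⟨ (λ n → cong₂ _+_ (∑A n) (shift-cong a ∑B n)) ⟩
    S ⊕ shift a S ∎
    where open ≗-Reasoning

  jacobiTerm : ℕ → ℕ → ℕ → Series
  jacobiTerm n m j = shift (triDiff j n) (qBinomial (m ℕ.+ n) j)

  jacobiTerm-> : ∀ n m j → m ℕ.+ n ℕ.< j → jacobiTerm n m j ≗ 0ˢ
  jacobiTerm-> n m j m+n<j = ≗.trans (shift-cong (triDiff j n) (qBinomial-> (m ℕ.+ n) j m+n<j)) (shift-0ˢ (triDiff j n))

  jacobiTerm-n-step : ∀ n j → jacobiTerm (suc n) 0 j ≗ previous (jacobiTerm n 0) j ⊕ shift n (jacobiTerm n 0 j)
  jacobiTerm-n-step n zero = begin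
    shift (tri n) 1ˢ                          ≡⟨ cong (λ t → shift t 1ˢ) (triDiff-0 n) ⟨
    shift (n ℕ.+ triDiff 0 n) 1ˢ              ≈⟨ shift-+ n (triDiff 0 n) 1ˢ ⟨
    shift n (shift (triDiff 0 n) 1ˢ)          ≈⟨ shift-cong n (shift-cong (triDiff 0 n) (qBinomial-0 n)) ⟨
    shift n (jacobiTerm n 0 0)                      ≈⟨ (λ i → ℤP.+-identityˡ _) ⟨
    0ˢ ⊕ shift n (jacobiTerm n 0 0)                 ∎
    where open ≗-Reasoning
  jacobiTerm-n-step n (suc j) = begin
    shift t (qBinomial n j ⊕ shift (suc j) (qBinomial n (suc j)))
      ≈⟨ shift-⊕ t (qBinomial n j) _ ⟩
    jacobiTerm n 0 j ⊕ shift t (shift (suc j) (qBinomial n (suc j)))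
      ≈⟨ (λ i → cong (_+_ (jacobiTerm n 0 j i)) (shift-+ t (suc j) _ i)) ⟩
    jacobiTerm n 0 j ⊕ shift (t ℕ.+ suc j) (qBinomial n (suc j))
      ≡⟨ cong (λ s → jacobiTerm n 0 j ⊕ shift s (qBinomial n (suc j))) (triDiff-step j n) ⟩
    jacobiTerm n 0 j ⊕ shift (n ℕ.+ triDiff (suc j) n) (qBinomial n (suc j))
      ≈⟨ (λ i → cong (_+_ (jacobiTerm n 0 j i)) (shift-+ n (triDiff (suc j) n) _ i)) ⟨
    jacobiTerm n 0 j ⊕ shift n (jacobiTerm n 0 (suc j)) ∎
    where
    open ≗-Reasoning
    t = triDiff j n

  jacobiTerm-m-step : ∀ n m j → jacobiTerm n (suc m) j ≗ jacobiTerm n m j ⊕ shift (suc m) (previous (jacobiTerm n m) j)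
  jacobiTerm-m-step n m zero = begin
    shift (triDiff 0 n) (qBinomial (suc m ℕ.+ n) 0)
      ≈⟨ shift-cong (triDiff 0 n) (≗.trans (qBinomial-0 (suc m ℕ.+ n)) (≗.sym (qBinomial-0 (m ℕ.+ n)))) ⟩
    jacobiTerm n m 0
      ≈⟨ (λ i → ℤP.+-identityʳ _) ⟨
    jacobiTerm n m 0 ⊕ 0ˢ
      ≈⟨ (λ i → cong (_+_ (jacobiTerm n m 0 i)) (shift-0ˢ (suc m) i)) ⟨
    jacobiTerm n m 0 ⊕ shift (suc m) 0ˢ ∎
    where open ≗-Reasoning
  jacobiTerm-m-step n m (suc j) with j ℕP.≤? m ℕ.+ n
  ... | yes j≤m+n = begin
    shift t (qBinomial (suc N) (suc j))
      ≈⟨ shift-cong t (qBinomial-pascal′ N j) ⟩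
    shift t (shift (N ℕ.∸ j) (qBinomial N j) ⊕ qBinomial N (suc j))
      ≈⟨ shift-⊕ t _ (qBinomial N (suc j)) ⟩
    shift t (shift (N ℕ.∸ j) (qBinomial N j)) ⊕ jacobiTerm n m (suc j)
      ≈⟨ (λ i → ℤP.+-comm (shift t (shift (N ℕ.∸ j) (qBinomial N j)) i) _) ⟩
    jacobiTerm n m (suc j) ⊕ shift t (shift (N ℕ.∸ j) (qBinomial N j))
      ≈⟨ (λ i → cong (_+_ (jacobiTerm n m (suc j) i)) (shift-+ t (N ℕ.∸ j) _ i)) ⟩
    jacobiTerm n m (suc j) ⊕ shift (t ℕ.+ (N ℕ.∸ j)) (qBinomial N j)
      ≡⟨ cong (λ s → jacobiTerm n m (suc j) ⊕ shift s (qBinomial N j)) (triDiff-step′ j n m j≤m+n) ⟩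
    jacobiTerm n m (suc j) ⊕ shift (suc m ℕ.+ triDiff j n) (qBinomial N j)
      ≈⟨ (λ i → cong (_+_ (jacobiTerm n m (suc j) i)) (shift-+ (suc m) (triDiff j n) _ i)) ⟨
    jacobiTerm n m (suc j) ⊕ shift (suc m) (jacobiTerm n m j) ∎
    where
    open ≗-Reasoning
    N = m ℕ.+ n
    t = triDiff (suc j) n
  ... | no j≰m+n = begin
    jacobiTerm n (suc m) (suc j)
      ≈⟨ jacobiTerm-> n (suc m) (suc j) (s≤s m+n<j) ⟩
    0ˢ
      ≈⟨ (λ i → ℤP.+-identityʳ (+ 0)) ⟨
    0ˢ ⊕ 0ˢ
      ≈⟨ (λ i → cong₂ _+_ (jacobiTerm-> n m (suc j) (ℕP.m<n⇒m<1+n m+n<j) i)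
          (trans (shift-cong (suc m) (jacobiTerm-> n m j m+n<j) i) (shift-0ˢ (suc m) i))) ⟨
    jacobiTerm n m (suc j) ⊕ shift (suc m) (jacobiTerm n m j) ∎
    where
    open ≗-Reasoning
    m+n<j = ℕP.≰⇒> j≰m+n

  -- A finite form of Jacobi's triple product identity at z = 1.
  triple-product : ∀ n m → ∑ˢ (suc (m ℕ.+ n)) (jacobiTerm n m) ≗ run (plusPochhammer 1 m) (run (plusPochhammer 0 n) 1ˢ)
  triple-product zero    zero    i = ℤP.+-identityˡ (1ˢ i)
  triple-product (suc n) zero    = begin
    ∑ˢ (suc (suc n)) (jacobiTerm (suc n) 0)
      ≈⟨ ∑ˢ-cong (suc (suc n)) (jacobiTerm-n-step n) ⟩
    ∑ˢ (suc (suc n)) (λ j → previous (jacobiTerm n 0) j ⊕ shift n (jacobiTerm n 0 j))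
      ≈⟨ ∑ˢ-1+q^ (suc (suc n)) n (∑ˢ-previous (suc n) (jacobiTerm n 0))
          (∑ˢ-last-0ˢ (suc n) (jacobiTerm n 0) (jacobiTerm-> n 0 (suc n) ℕP.≤-refl)) ⟩
    apply (1+q^ n) (∑ˢ (suc n) (jacobiTerm n 0))
      ≈⟨ Linear.cong-≗ (apply-linear (1+q^ n)) (triple-product n zero) ⟩
    apply (1+q^ n) (run (plusPochhammer 0 n) 1ˢ) ∎
    where open ≗-Reasoning
  triple-product n (suc m) = begin
    ∑ˢ (suc (suc N)) (jacobiTerm n (suc m))
      ≈⟨ ∑ˢ-cong (suc (suc N)) (jacobiTerm-m-step n m) ⟩
    ∑ˢ (suc (suc N)) (λ j → jacobiTerm n m j ⊕ shift (suc m) (previous (jacobiTerm n m) j))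
      ≈⟨ ∑ˢ-1+q^ (suc (suc N)) (suc m)
          (∑ˢ-last-0ˢ (suc N) (jacobiTerm n m) (jacobiTerm-> n m (suc N) ℕP.≤-refl))
          (∑ˢ-previous (suc N) (jacobiTerm n m)) ⟩
    apply (1+q^ (suc m)) (∑ˢ (suc N) (jacobiTerm n m))
      ≈⟨ Linear.cong-≗ (apply-linear (1+q^ (suc m))) (triple-product n m) ⟩
    apply (1+q^ (suc m)) (run (plusPochhammer 1 m) (run (plusPochhammer 0 n) 1ˢ)) ∎
    where
    open ≗-Reasoning
    N = m ℕ.+ n

  ψ : ℕ → Series
  ψ K = ∑ˢ K λ s → shift (tri s) 1ˢ

  -- Each T(s) occurs twice among the exponents T(j - n), j < 2n.
  triDiff-sum : ∀ n → ∑ˢ (n ℕ.+ n) (λ j → shift (triDiff j n) 1ˢ) ≗ (+ 2) · ψ n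
  triDiff-sum zero    i = refl
  triDiff-sum (suc n) i = begin
    ∑ˢ (suc (n ℕ.+ suc n)) (λ j → shift (triDiff j (suc n)) 1ˢ) i
      ≡⟨ ∑ˢ-first (n ℕ.+ suc n) (λ j → shift (triDiff j (suc n)) 1ˢ) i ⟩
    shift (tri n) 1ˢ i + ∑ˢ (n ℕ.+ suc n) (λ j → shift (triDiff j n) 1ˢ) i
      ≡⟨ cong (λ K → shift (tri n) 1ˢ i + ∑ˢ K (λ j → shift (triDiff j n) 1ˢ) i) (ℕP.+-suc n n) ⟩
    shift (tri n) 1ˢ i + (∑ˢ (n ℕ.+ n) (λ j → shift (triDiff j n) 1ˢ) i + shift (triDiff (n ℕ.+ n) n) 1ˢ i)
        ≡⟨ cong (_+_ (shift (tri n) 1ˢ i)) (cong₂ _+_ (triDiff-sum n i) (cong (λ t → shift t 1ˢ i) (triDiff-+ n n))) ⟩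
    shift (tri n) 1ˢ i + (+ 2 * ψ n i + shift (tri n) 1ˢ i)
      ≡⟨ collect (shift (tri n) 1ˢ i) (ψ n i) ⟩
    + 2 * (ψ n i + shift (tri n) 1ˢ i) ∎
    where
    open ≡-Reasoning
    collect : ∀ (a p : ℤ) → a + (+ 2 * p + a) ≡ + 2 * (p + a)
    collect = solve-∀

  module _ (n′ : ℕ) where
    private
      N = n′ ℕ.+ suc n′
      N∸n′ : N ℕ.∸ n′ ≡ suc n′
      N∸n′ = ℕP.m+n∸m≡n n′ (suc n′)

    qPochhammer-qBinomial-half : ∀ i → i ℕ.≤ n′ → run (qPochhammer n′) (qBinomial N i) ≈[ i ] 1ˢ
    qPochhammer-qBinomial-half i i≤n′ = qPochhammer-qBinomial-invisible N n′ i i≤n′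
      (ℕP.≤-trans (ℕP.m≤n⇒m≤1+n i≤n′) (subst (ℕ._≤ N ℕ.∸ i) N∸n′ (ℕP.∸-monoʳ-≤ N i≤n′)))

    private
      low : ∀ M s → M ℕ.≤ n′ → M ℕ.∸ tri s ℕ.≤ n′ ℕ.∸ s
      low M s M≤n′ = ℕP.≤-trans (ℕP.∸-monoʳ-≤ M (n≤tri s)) (ℕP.∸-monoˡ-≤ s M≤n′)

    qPochhammer-qBinomial-low : ∀ M j → M ℕ.≤ n′ → j ℕ.≤ N →
                        run (qPochhammer n′) (qBinomial N j) ≈[ M ℕ.∸ triDiff j (suc n′) ] 1ˢ
    qPochhammer-qBinomial-low M j M≤n′ j≤N with j ℕP.≤? n′
    ... | yes j≤n′ rewrite triDiff-≤ j n′ j≤n′ =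
      ≈-weaken (subst (M ℕ.∸ tri (n′ ℕ.∸ j) ℕ.≤_) (ℕP.m∸[m∸n]≡n j≤n′) (low M (n′ ℕ.∸ j) M≤n′))
               (qPochhammer-qBinomial-half j j≤n′)
    ... | no j≰n′ rewrite sym (ℕP.m+[n∸m]≡n (ℕP.≰⇒> j≰n′)) | triDiff-+ (suc n′) (j ℕ.∸ suc n′) =
      λ n n≤ → trans (Linear.cong-≗ (run-linear (qPochhammer n′)) (qBinomial-sym N j′ j≤N) n)
                     (trans (cong (λ i → run (qPochhammer n′) (qBinomial N i) n) N∸j)
                            (≈-weaken (low M k M≤n′) (qPochhammer-qBinomial-half (n′ ℕ.∸ k) (ℕP.m∸n≤m n′ k)) n n≤))
      where
      k = j ℕ.∸ suc n′
      j′ = suc n′ ℕ.+ k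
      N∸j : N ℕ.∸ j′ ≡ n′ ℕ.∸ k
      N∸j = trans (cong (ℕ._∸ j′) (ℕP.+-comm n′ (suc n′))) (ℕP.[m+n]∸[m+o]≡n∸o (suc n′) n′ k)

  plusPochhammer-0 : ∀ k X → run (plusPochhammer 0 (suc k)) X ≗ run (plusPochhammer 1 k) (apply (1+q^ 0) X)
  plusPochhammer-0 zero    X n = refl
  plusPochhammer-0 (suc k) X   = Linear.cong-≗ (apply-linear (1+q^ (suc k))) (plusPochhammer-0 k X)

  -- Truncation of Gauss's ψ(q) = (q;q)_∞ (-q;q)_∞².
  ψ-product : ∀ M n′ → M ℕ.≤ n′ →
              ψ (suc n′) ≈[ M ] run (qPochhammer n′) (run (plusPochhammer 1 n′) (run (plusPochhammer 1 n′) 1ˢ))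
  ψ-product M n′ M≤n′ n n≤M = ℤP.*-cancelˡ-≡ (+ 2) _ _ (begin
    + 2 * ψ (suc n′) n
      ≡⟨ triDiff-sum (suc n′) n ⟨
    ∑ˢ K (λ j → shift (triDiff j (suc n′)) 1ˢ) n
      ≡⟨ ∑ˢ-causal K M (λ j j<K → ≈-sym (shift-causal∸ (triDiff j (suc n′)) M
          (qPochhammer-qBinomial-low n′ M j M≤n′ (ℕP.≤-pred j<K)))) n n≤M ⟩
    ∑ˢ K (λ j → shift (triDiff j (suc n′)) (Q (qBinomial N j))) n
      ≡⟨ ∑ˢ-cong K (λ j → ≗.sym (Linear.shift-hom Q-linear (triDiff j (suc n′)) (qBinomial N j))) n ⟩
    ∑ˢ K (Q ∘ jacobiTerm (suc n′) n′) n
      ≡⟨ Linear-properties.∑ˢ-hom Q-linear K (jacobiTerm (suc n′) n′) n ⟨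
    Q (∑ˢ K (jacobiTerm (suc n′) n′)) n
      ≡⟨ Linear.cong-≗ Q-linear (triple-product (suc n′) n′) n ⟩
    Q (P (run (plusPochhammer 0 (suc n′)) 1ˢ)) n
      ≡⟨ Linear.cong-≗ (∘-linear Q-linear P-linear) (plusPochhammer-0 n′ 1ˢ) n ⟩
    Q (P (P (1ˢ ⊕ 1ˢ))) n
      ≡⟨ Linear.cong-≗ QPP-linear (λ i → double (1ˢ i)) n ⟩
    Q (P (P (+ 2 · 1ˢ))) n
      ≡⟨ Linear.·-hom QPP-linear (+ 2) 1ˢ n ⟩
    + 2 * Q (P (P 1ˢ)) n ∎)
    where
    open ≡-Reasoning
    N = n′ ℕ.+ suc n′
    K = suc N
    Q = run (qPochhammer n′)
    P = run (plusPochhammer 1 n′)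
    Q-linear : Linear Q
    Q-linear = run-linear (qPochhammer n′)
    P-linear : Linear P
    P-linear = run-linear (plusPochhammer 1 n′)
    QPP-linear : Linear (Q ∘ P ∘ P)
    QPP-linear = ∘-linear Q-linear (∘-linear P-linear P-linear)
    double : ∀ (x : ℤ) → x + x ≡ + 2 * x
    double = solve-∀

  1+q^-as-quotient : ∀ b Y → apply (1+q^ (suc b)) Y ≗ apply (1-q^ (2 ℕ.+ b ℕ.* 2)) (geometric b Y)
  1+q^-as-quotient b Y = begin
    Y ⊕ shift (suc b) Y
      ≈⟨ (λ n → cong₂ _+_ (inverse n) (shift-cong (suc b) inverse n)) ⟨
    Δ (suc b) G ⊕ shift (suc b) (Δ (suc b) G)
      ≈⟨ 1-q^-telescope (suc b) (suc b) G ⟩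
    Δ (suc b ℕ.+ suc b) G
      ≡⟨ cong (λ a → Δ a G) (index b) ⟩
    Δ (2 ℕ.+ b ℕ.* 2) G ∎
    where
    open ≗-Reasoning
    G = geometric b Y
    inverse = geometric-inverseʳ b Y
    index : ∀ b → suc b ℕ.+ suc b ≡ 2 ℕ.+ b ℕ.* 2
    index = ℕSolver.solve-∀

  evens : ℕ → ℤ
  evens = dilate 1 λ _ → + 1

  plusPochhammer-eta : ∀ k X → run (plusPochhammer 1 k) X ≗ run (eta (k ℕ.* 2) evens) (run (eta k λ _ → -1ℤ) X)
  plusPochhammer-eta k X = begin
    run (plusPochhammer 1 k) X
      ≈⟨ ∏-cong k (λ b → 1+q^-as-quotient b) X ⟩
    run (∏ k λ b → power (1 ℕ.+ b ℕ.* 2) (+ 1) ++ power b -1ℤ) X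
      ≈⟨ ∏-++ k (λ b → power (1 ℕ.+ b ℕ.* 2) (+ 1)) (λ b → power b -1ℤ) X ⟩
    run (∏ k λ b → power (1 ℕ.+ b ℕ.* 2) (+ 1)) (run (eta k λ _ → -1ℤ) X)
      ≡⟨ cong (λ xs → run xs (run (eta k λ _ → -1ℤ) X)) (eta-dilate 1 k λ _ → + 1) ⟨
    run (eta (k ℕ.* 2) evens) (run (eta k λ _ → -1ℤ) X) ∎
    where open ≗-Reasoning

  -- The eta exponents of ψ(q) = (q²;q²)_∞ / (q;q²)_∞.
  ψExponent : ℕ → ℤ
  ψExponent zero          = -1ℤ
  ψExponent (suc zero)    = + 1
  ψExponent (suc (suc b)) = ψExponent b

  private
    ψExponent-sum : ∀ b → + 1 + (evens b + (-1ℤ + (evens b + -1ℤ))) ≡ ψExponent b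
    ψExponent-sum zero          = refl
    ψExponent-sum (suc zero)    = refl
    ψExponent-sum (suc (suc b)) =
      trans (cong (λ t → + 1 + (t + (-1ℤ + (t + -1ℤ)))) (dilate-step 1 (λ _ → + 1) b)) (ψExponent-sum b)

    eta-truncate-run : ∀ {K K′} e {X Y} → K ℕ.≤ K′ → X ≈[ K ] Y → run (eta K′ e) X ≈[ K ] run (eta K e) Y
    eta-truncate-run {K} e {X} K≤K′ X≈Y = ≈-trans (eta-truncate e X K≤K′) (Linear.causal (run-linear (eta K e)) K X≈Y)

  ψ-eta : ∀ M n′ → M ℕ.≤ n′ → ψ (suc n′) ≈[ M ] run (eta M ψExponent) 1ˢ
  ψ-eta M n′ M≤n′ =
    ≈-trans (ψ-product M n′ M≤n′) (≈-trans (≗⇒≈ rewrite-as-eta) (≈-trans truncate (≗⇒≈ combine)))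
    where
    open ≗-Reasoning
    one = λ (_ : ℕ) → + 1
    minus = λ (_ : ℕ) → -1ℤ
    run-at : ℕ → (ℕ → ℤ) → Series → Series
    run-at K e = run (eta K e)
    linear : ∀ e → Linear (run-at M e)
    linear e = run-linear (eta M e)
    rewrite-as-eta : run (qPochhammer n′) (run (plusPochhammer 1 n′) (run (plusPochhammer 1 n′) 1ˢ))
                   ≗ run-at n′ one (run-at (n′ ℕ.* 2) evens (run-at n′ minus (run-at (n′ ℕ.* 2) evens (run-at n′ minus 1ˢ))))
    rewrite-as-eta = Linear.cong-≗ (run-linear (qPochhammer n′))
      (≗.trans (plusPochhammer-eta n′ _)
               (Linear.cong-≗ (∘-linear (run-linear (eta (n′ ℕ.* 2) evens)) (run-linear (eta n′ minus))) (plusPochhammer-eta n′ 1ˢ)))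
    M≤2n′ = ℕP.≤-trans M≤n′ (ℕP.m≤m*n n′ 2)
    truncate : run-at n′ one (run-at (n′ ℕ.* 2) evens (run-at n′ minus (run-at (n′ ℕ.* 2) evens (run-at n′ minus 1ˢ))))
             ≈[ M ] run-at M one (run-at M evens (run-at M minus (run-at M evens (run-at M minus 1ˢ))))
    truncate = eta-truncate-run one M≤n′ (eta-truncate-run evens M≤2n′ (eta-truncate-run minus M≤n′
                 (eta-truncate-run evens M≤2n′ (eta-truncate-run minus M≤n′ ≈-refl))))
    combine : run-at M one (run-at M evens (run-at M minus (run-at M evens (run-at M minus 1ˢ)))) ≗ run-at M ψExponent 1ˢ
    combine = begin
      run-at M one (run-at M evens (run-at M minus (run-at M evens (run-at M minus 1ˢ))))
        ≈⟨ Linear.cong-≗ (∘-linear (linear one) (∘-linear (linear evens) (linear minus))) (eta-+ M evens minus 1ˢ) ⟩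
      run-at M one (run-at M evens (run-at M minus (run-at M (λ b → evens b + -1ℤ) 1ˢ)))
        ≈⟨ Linear.cong-≗ (∘-linear (linear one) (linear evens)) (eta-+ M minus (λ b → evens b + -1ℤ) 1ˢ) ⟩
      run-at M one (run-at M evens (run-at M (λ b → -1ℤ + (evens b + -1ℤ)) 1ˢ))
        ≈⟨ Linear.cong-≗ (linear one) (eta-+ M evens (λ b → -1ℤ + (evens b + -1ℤ)) 1ˢ) ⟩
      run-at M one (run-at M (λ b → evens b + (-1ℤ + (evens b + -1ℤ))) 1ˢ)
        ≈⟨ eta-+ M one (λ b → evens b + (-1ℤ + (evens b + -1ℤ))) 1ˢ ⟩
      run-at M (λ b → + 1 + (evens b + (-1ℤ + (evens b + -1ℤ)))) 1ˢ
        ≡⟨ cong (λ xs → run xs 1ˢ) (eta-cong M λ b _ → ψExponent-sum b) ⟩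
      run-at M ψExponent 1ˢ
        ∎

module Counting where

  open import Data.Nat as ℕ using (ℕ; zero; suc; _+_; _*_; _≡ᵇ_; _<_)
  import Data.Nat.Properties as ℕP
  open import Data.Bool using (true; false; if_then_else_; T)
  open import Data.Unit using (tt)
  open import Data.Sum using (inj₁; inj₂)
  open import Relation.Nullary using (contradiction)
  open import Relation.Binary.PropositionalEquality
  open TripleProduct using (tri)

  ∑ : ℕ → (ℕ → ℕ) → ℕ
  ∑ zero    f = 0
  ∑ (suc K) f = ∑ K f + f K

  indicator : ℕ → ℕ → ℕ
  indicator x N = if x ≡ᵇ N then 1 else 0

  count : ℕ → ℕ → ℕ
  count K N = ∑ K λ a → ∑ K λ b → indicator (tri a + tri b) N

  ∑-cong : ∀ K {f g} → (∀ a → a < K → f a ≡ g a) → ∑ K f ≡ ∑ K g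
  ∑-cong zero    f≡g = refl
  ∑-cong (suc K) f≡g = cong₂ _+_ (∑-cong K λ a a<K → f≡g a (ℕP.m<n⇒m<1+n a<K)) (f≡g K ℕP.≤-refl)

  ∑-+ : ∀ K L f → ∑ (K + L) f ≡ ∑ L f + ∑ K (λ i → f (i + L))
  ∑-+ zero    L f = sym (ℕP.+-identityʳ (∑ L f))
  ∑-+ (suc K) L f = trans (cong (_+ f (K + L)) (∑-+ K L f)) (ℕP.+-assoc (∑ L f) _ (f (K + L)))

  ∑-blocks : ∀ C m f → ∑ (C * m) f ≡ ∑ C λ c → ∑ m λ r → f (r + c * m)
  ∑-blocks zero    m f = refl
  ∑-blocks (suc C) m f = trans (∑-+ m (C * m) f) (cong (_+ ∑ m (λ r → f (r + C * m))) (∑-blocks C m f))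

  ∑-zero : ∀ m f → (∀ r → r < m → f r ≡ 0) → ∑ m f ≡ 0
  ∑-zero zero    f vanish = refl
  ∑-zero (suc m) f vanish = cong₂ _+_ (∑-zero m f λ r r<m → vanish r (ℕP.m<n⇒m<1+n r<m)) (vanish m ℕP.≤-refl)

  ∑-single : ∀ m r₀ f → r₀ < m → (∀ r → r < m → r ≢ r₀ → f r ≡ 0) → ∑ m f ≡ f r₀
  ∑-single (suc m) r₀ f r₀<1+m vanish with ℕP.m≤n⇒m<n∨m≡n (ℕP.≤-pred r₀<1+m)
  ... | inj₁ r₀<m = trans (cong₂ _+_ (∑-single m r₀ f r₀<m λ r r<m → vanish r (ℕP.m<n⇒m<1+n r<m))
                                     (vanish m ℕP.≤-refl λ m≡r₀ → ℕP.<-irrefl (sym m≡r₀) r₀<m))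
                          (ℕP.+-identityʳ (f r₀))
  ... | inj₂ refl = cong (_+ f r₀) (∑-zero r₀ f λ r r<r₀ → vanish r (ℕP.m<n⇒m<1+n r<r₀) (ℕP.<⇒≢ r<r₀))

  indicator-≢ : ∀ {x N} → x ≢ N → indicator x N ≡ 0
  indicator-≢ {x} {N} x≢N with x ≡ᵇ N in eq
  ... | true  = contradiction (ℕP.≡ᵇ⇒≡ x N (subst T (sym eq) tt)) x≢N
  ... | false = refl

  indicator-cong : ∀ {x N y M} → (x ≡ N → y ≡ M) → (y ≡ M → x ≡ N) → indicator x N ≡ indicator y M
  indicator-cong {x} {N} {y} {M} ⇒ ⇐ with x ≡ᵇ N in eq₁ | y ≡ᵇ M in eq₂
  ... | true  | true  = refl
  ... | false | false = refl
  ... | true  | false = contradiction (subst T eq₂ (ℕP.≡⇒≡ᵇ y M (⇒ (ℕP.≡ᵇ⇒≡ x N (subst T (sym eq₁) tt))))) λ ()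
  ... | false | true  = contradiction (subst T eq₁ (ℕP.≡⇒≡ᵇ x N (⇐ (ℕP.≡ᵇ⇒≡ y M (subst T (sym eq₂) tt))))) λ ()

  module _ {m r₀ N₁ N₂ : ℕ} (r₀<m : r₀ < m)
           (residue : ∀ r c b → r < m → tri (r + c * m) + tri b ≡ N₁ → r ≡ r₀)
           (scale⇒ : ∀ c d → tri (r₀ + c * m) + tri (r₀ + d * m) ≡ N₁ → tri c + tri d ≡ N₂)
           (scale⇐ : ∀ c d → tri c + tri d ≡ N₂ → tri (r₀ + c * m) + tri (r₀ + d * m) ≡ N₁) where

    -- Only a ≡ b ≡ r₀ (mod m) contribute, and a = r₀ + c m, b = r₀ + d m then correspond to (c, d).
    count-regroup : ∀ C → count (C * m) N₁ ≡ count C N₂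
    count-regroup C = begin
      count (C * m) N₁
        ≡⟨ ∑-blocks C m row ⟩
      ∑ C (λ c → ∑ m λ r → row (r + c * m))
        ≡⟨ ∑-cong C (λ c _ → ∑-single m r₀ _ r₀<m λ r r<m r≢r₀ →
            ∑-zero (C * m) _ λ b _ → indicator-≢ λ eq → r≢r₀ (residue r c b r<m eq)) ⟩
      ∑ C (λ c → row (r₀ + c * m))
        ≡⟨ ∑-cong C (λ c _ → ∑-blocks C m (λ b → indicator (tri (r₀ + c * m) + tri b) N₁)) ⟩
      ∑ C (λ c → ∑ C λ d → ∑ m λ r → indicator (tri (r₀ + c * m) + tri (r + d * m)) N₁)
          ≡⟨ ∑-cong C (λ c _ → ∑-cong C λ d _ → ∑-single m r₀ _ r₀<m λ r r<m r≢r₀ →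
               indicator-≢ λ eq → r≢r₀ (residue r d (r₀ + c * m) r<m (trans (ℕP.+-comm (tri (r + d * m)) _) eq))) ⟩
      ∑ C (λ c → ∑ C λ d → indicator (tri (r₀ + c * m) + tri (r₀ + d * m)) N₁)
          ≡⟨ ∑-cong C (λ c _ → ∑-cong C λ d _ → indicator-cong (scale⇒ c d) (scale⇐ c d)) ⟩
      count C N₂ ∎
      where
      open ≡-Reasoning
      row : ℕ → ℕ
      row a = ∑ (C * m) λ b → indicator (tri a + tri b) N₁

module Pod where

  open import Defs
  open Series
  open EtaProducts
  open Congruence
  open TripleProduct
  open Counting using (∑; indicator; count)
  open import Data.Integer.Divisibility.Signed using (_∣_; ∣⇒∣ᵤ; ∣m⇒∣-m; ∣m∣n⇒∣m-n)
  open import Data.Nat as ℕ using (ℕ; zero; suc; s≤s; _≤ᵇ_)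
  import Data.Nat.Properties as ℕP
  open import Data.Nat.DivMod using (_%_; _/_; m≡m%n+[m/n]*n; m%n<n; %-distribˡ-*; [m+kn]%n≡m%n; %-remove-+ˡ)
  open import Relation.Nullary using (contradiction)
  open import Data.Integer as ℤ using (ℤ; +_; -1ℤ; _+_; _-_; -_)
  open import Data.Integer.Tactic.RingSolver using (solve-∀)
  open import Data.Sum using (inj₁; inj₂)
  import Data.Integer.Properties as ℤP
  open import Data.Bool using (true; false; if_then_else_; T)
  open import Data.Unit using (tt)
  open import Function.Base using (_∘_)
  open import Relation.Binary.PropositionalEquality

  signed : ℕ → ℤ → ℤ
  signed zero    z = z
  signed (suc n) z = - signed n z

  signed-+ : ∀ n x y → signed n (x + y) ≡ signed n x + signed n y
  signed-+ zero    x y = refl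
  signed-+ (suc n) x y = trans (cong -_ (signed-+ n x y)) (ℤP.neg-distrib-+ (signed n x) (signed n y))

  signed-0 : ∀ n → signed n (+ 0) ≡ + 0
  signed-0 zero    = refl
  signed-0 (suc n) = cong -_ (signed-0 n)

  signed-neg : ∀ n z → signed n (- z) ≡ - signed n z
  signed-neg zero    z = refl
  signed-neg (suc n) z = cong -_ (signed-neg n z)

  signed-add : ∀ a b z → signed (a ℕ.+ b) z ≡ signed a (signed b z)
  signed-add zero    b z = refl
  signed-add (suc a) b z = cong -_ (signed-add a b z)

  signed-even : ∀ k z → signed (k ℕ.* 2) z ≡ z
  signed-even zero    z = refl
  signed-even (suc k) z = trans (ℤP.neg-involutive (signed (k ℕ.* 2) z)) (signed-even k z)

  signed-%2 : ∀ a z → signed a z ≡ signed (a % 2) z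
  signed-%2 a z = begin
    signed a z                                ≡⟨ cong (λ x → signed x z) (m≡m%n+[m/n]*n a 2) ⟩
    signed (a % 2 ℕ.+ (a / 2) ℕ.* 2) z        ≡⟨ signed-add (a % 2) ((a / 2) ℕ.* 2) z ⟩
    signed (a % 2) (signed ((a / 2) ℕ.* 2) z) ≡⟨ cong (signed (a % 2)) (signed-even (a / 2) z) ⟩
    signed (a % 2) z                          ∎
    where open ≡-Reasoning

  signed-even-parity : ∀ a z → a % 2 ≡ 0 → signed a z ≡ z
  signed-even-parity a z a-even = trans (signed-%2 a z) (cong (λ x → signed x z) a-even)

  signed-odd-parity : ∀ a z → a % 2 ≡ 1 → signed a z ≡ - z
  signed-odd-parity a z a-odd = trans (signed-%2 a z) (cong (λ x → signed x z) a-odd)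

  signedSeries : (ℕ → ℕ) → Series
  signedSeries v n = signed n (+ v n)

  signed-shift : ∀ x v n → signed n (+ (if x ≤ᵇ n then v (n ℕ.∸ x) else 0)) ≡ signed x (shift x (signedSeries v) n)
  signed-shift x v n with x ≤ᵇ n in x≤ᵇn
  ... | true = begin
    signed n (+ v (n ℕ.∸ x))                   ≡⟨ cong (λ m → signed m (+ v (n ℕ.∸ x))) (ℕP.m+[n∸m]≡n x≤n) ⟨
    signed (x ℕ.+ (n ℕ.∸ x)) (+ v (n ℕ.∸ x))   ≡⟨ signed-add x (n ℕ.∸ x) _ ⟩
    signed x (signedSeries v (n ℕ.∸ x))        ≡⟨ cong (signed x) (shift-≥ x (signedSeries v) x≤n) ⟨
    signed x (shift x (signedSeries v) n)      ∎
    where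
    open ≡-Reasoning
    x≤n = ℕP.≤ᵇ⇒≤ x n (subst T (sym x≤ᵇn) tt)
  ... | false = trans (signed-0 n) (sym (trans (cong (signed x) (shift-< x (signedSeries v) n<x)) (signed-0 x)))
    where
    n<x = ℕP.≰⇒> λ x≤n → subst T x≤ᵇn (ℕP.≤⇒≤ᵇ x≤n)

  signedPod : ℕ → Series
  signedPod m = signedSeries (podUpTo m)

  -- The exponent of 1 - q^k in ∑ (-1)^n pod₃(n) q^n, read off from k % 3 and k % 2: parts divisible by 3
  -- are excluded, a distinct odd part k contributes 1 + (-q)^k = 1 - q^k, an even part 1/(1 - q^k).
  partExponent : ℕ → ℕ → ℤ
  partExponent zero    _       = + 0
  partExponent (suc _) (suc _) = + 1
  partExponent (suc _) zero    = -1ℤ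

  podExponent : ℕ → ℤ
  podExponent b = partExponent (suc b % 3) (suc b % 2)

  signed-evenSum : ∀ m r n → suc m % 2 ≡ 0 →
                   signed n (+ evenSum m r n) ≡ ∑ˢ (suc r) (λ j → shift (j ℕ.* suc m) (signedPod m)) n
  signed-evenSum m zero    n _    = sym (ℤP.+-identityˡ _)
  signed-evenSum m (suc r) n even = begin
    signed n (+ (term ℕ.+ evenSum m r n))
      ≡⟨ signed-+ n (+ term) (+ evenSum m r n) ⟩
    signed n (+ term) + signed n (+ evenSum m r n)
      ≡⟨ cong₂ _+_ (signed-shift x (podUpTo m) n) (signed-evenSum m r n even) ⟩
    signed x (shift x (signedPod m) n) + ∑ˢ (suc r) F n
      ≡⟨ cong (_+ ∑ˢ (suc r) F n) (signed-even-parity x (shift x (signedPod m) n) x-even) ⟩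
    shift x (signedPod m) n + ∑ˢ (suc r) F n
      ≡⟨ ℤP.+-comm _ (∑ˢ (suc r) F n) ⟩
    ∑ˢ (suc r) F n + shift x (signedPod m) n ∎
    where
    open ≡-Reasoning
    x = suc r ℕ.* suc m
    term = if x ≤ᵇ n then podUpTo m (n ℕ.∸ x) else 0
    F = λ j → shift (j ℕ.* suc m) (signedPod m)
    x-even : x % 2 ≡ 0
    x-even = trans (%-distribˡ-* (suc r) (suc m) 2) (trans (cong (λ y → (suc r % 2 ℕ.* y) % 2) even) (cong (_% 2) (ℕP.*-zeroʳ (suc r % 2))))

  private
    %2≡suc⇒%2≡1 : ∀ a {k} → a % 2 ≡ suc k → a % 2 ≡ 1
    %2≡suc⇒%2≡1 a {zero}  a%2≡1 = a%2≡1
    %2≡suc⇒%2≡1 a {suc k} a%2≡2+k = contradiction (subst (ℕ._< 2) a%2≡2+k (m%n<n a 2)) λ { (s≤s (s≤s ())) }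

  signedPod-step : ∀ m → signedPod (suc m) ≗ run (power m (podExponent m)) (signedPod m)
  signedPod-step m n with suc m % 3 | suc m % 2 in parity
  ... | zero  | _     = refl
  ... | suc _ | suc _ = begin
    signed n (+ podUpTo m n + + odd)
      ≡⟨ signed-+ n (+ podUpTo m n) (+ odd) ⟩
    signedPod m n + signed n (+ odd)
      ≡⟨ cong (_+_ (signedPod m n)) (signed-shift (suc m) (podUpTo m) n) ⟩
    signedPod m n + signed (suc m) (shift (suc m) (signedPod m) n)
      ≡⟨ cong (_+_ (signedPod m n)) (signed-odd-parity (suc m) _ (%2≡suc⇒%2≡1 (suc m) parity)) ⟩
    signedPod m n - shift (suc m) (signedPod m) n ∎
    where
    open ≡-Reasoning
    odd = if suc m ≤ᵇ n then podUpTo m (n ℕ.∸ suc m) else 0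
  ... | suc _ | zero = begin
    signed n (+ evenSum m n n)                                   ≡⟨ signed-evenSum m n n parity ⟩
    ∑ˢ (suc n) (λ j → shift (j ℕ.* suc m) (signedPod m)) n       ≡⟨ geometricUpTo-∑ˢ m (signedPod m) n n ⟨
    geometric m (signedPod m) n                                  ∎
    where open ≡-Reasoning

  signedPod-eta : ∀ m → signedPod m ≗ run (eta m podExponent) 1ˢ
  signedPod-eta zero    zero    = refl
  signedPod-eta zero    (suc n) = signed-0 (suc n)
  signedPod-eta (suc m)         =
    ≗.trans (signedPod-step m) (≗.trans (Linear.cong-≗ (run-linear (power m (podExponent m))) (signedPod-eta m))
                                        (≗.sym (run-++ (power m (podExponent m)) (eta m podExponent) 1ˢ)))

  podExponent-periodic : ∀ b → podExponent (6 ℕ.+ b) ≡ podExponent b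
  podExponent-periodic b = cong₂ partExponent
    (trans (cong (_% 3) (ℕP.+-comm 6 (suc b))) ([m+kn]%n≡m%n (suc b) 2 3))
    (trans (cong (_% 2) (ℕP.+-comm 6 (suc b))) ([m+kn]%n≡m%n (suc b) 3 2))

  -- ψ(q)² = (ψ(q³)/ψ(q)) · (ψ(q)³/ψ(q³))
  ψ²-exponent : ∀ b → ψExponent b + ψExponent b ≡ podExponent b + (triple (ψExponent b) - dilate 2 ψExponent b)
  ψ²-exponent 0 = refl
  ψ²-exponent 1 = refl
  ψ²-exponent 2 = refl
  ψ²-exponent 3 = refl
  ψ²-exponent 4 = refl
  ψ²-exponent 5 = refl
  ψ²-exponent (suc (suc (suc (suc (suc (suc b)))))) = begin
    ψExponent b + ψExponent b
      ≡⟨ ψ²-exponent b ⟩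
    podExponent b + (triple (ψExponent b) - dilate 2 ψExponent b)
      ≡⟨ cong₂ (λ p d → p + (triple (ψExponent b) - d))
          (podExponent-periodic b) (trans (dilate-step 2 ψExponent (3 ℕ.+ b)) (dilate-step 2 (ψExponent ∘ suc) b)) ⟨
    podExponent (6 ℕ.+ b) + (triple (ψExponent b) - dilate 2 ψExponent (6 ℕ.+ b)) ∎
    where open ≡-Reasoning

  ψ²-eta : ∀ N n′ → N ℕ.≤ n′ → ψ (suc n′) ⋆ ψ (suc n′) ≈[ N ] run (eta N λ b → ψExponent b + ψExponent b) 1ˢ
  ψ²-eta N n′ N≤n′ =
    ≈-trans (Linear.causal (⋆-linear Ψ) N ψ≈E)
    (≈-trans (≗⇒≈ (≗.trans (Linear-properties.run-comm (⋆-linear Ψ) (eta N ψExponent) 1ˢ)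
                           (Linear.cong-≗ (run-linear (eta N ψExponent)) (⋆-identityˡ Ψ))))
    (≈-trans (Linear.causal (run-linear (eta N ψExponent)) N ψ≈E)
             (≗⇒≈ (eta-+ N ψExponent ψExponent 1ˢ))))
    where
    Ψ = ψ (suc n′)
    ψ≈E : Ψ ≈[ N ] run (eta N ψExponent) 1ˢ
    ψ≈E = ψ-eta N n′ N≤n′

  signedPod≡ψ² : ∀ N n′ → N ℕ.≤ n′ → signedPod N ≡ ψ (suc n′) ⋆ ψ (suc n′) [mod + 3 ]≤ N
  signedPod≡ψ² N n′ N≤n′ =
    ≡mod-sym (≡mod-trans (≈⇒≡mod (≈-trans (ψ²-eta N n′ N≤n′) (≗⇒≈ split))) (≡mod-trans frobenius (≗⇒≡mod cancel)))
    where
    cubed = λ b → triple (ψExponent b)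
    dilated = λ b → - dilate 2 ψExponent b
    run-at = λ e → run (eta N e)
    split : run-at (λ b → ψExponent b + ψExponent b) 1ˢ ≗ run-at podExponent (run-at cubed (run-at dilated 1ˢ))
    split = begin
      run-at (λ b → ψExponent b + ψExponent b) 1ˢ
        ≡⟨ cong (λ xs → run xs 1ˢ) (eta-cong N λ b _ → ψ²-exponent b) ⟩
      run-at (λ b → podExponent b + (cubed b + dilated b)) 1ˢ
        ≈⟨ eta-+ N podExponent (λ b → cubed b + dilated b) 1ˢ ⟨
      run-at podExponent (run-at (λ b → cubed b + dilated b) 1ˢ)
        ≈⟨ Linear.cong-≗ (run-linear (eta N podExponent)) (eta-+ N cubed dilated 1ˢ) ⟨
      run-at podExponent (run-at cubed (run-at dilated 1ˢ)) ∎
      where open ≗-Reasoning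
    frobenius : run-at podExponent (run-at cubed (run-at dilated 1ˢ))
                ≡ run-at podExponent (run-at (dilate 2 ψExponent) (run-at dilated 1ˢ)) [mod + 3 ]≤ N
    frobenius = Linear-preserves-≡mod (run-linear (eta N podExponent)) (eta-frobenius N ψExponent (run-at dilated 1ˢ))
    cancel : run-at podExponent (run-at (dilate 2 ψExponent) (run-at dilated 1ˢ)) ≗ signedPod N
    cancel = begin
      run-at podExponent (run-at (dilate 2 ψExponent) (run-at dilated 1ˢ))
        ≈⟨ Linear.cong-≗ (run-linear (eta N podExponent)) (eta-+ N (dilate 2 ψExponent) dilated 1ˢ) ⟩
      run-at podExponent (run-at (λ b → dilate 2 ψExponent b - dilate 2 ψExponent b) 1ˢ)
        ≡⟨ cong (λ xs → run-at podExponent (run xs 1ˢ)) (eta-cong N λ b _ → ℤP.+-inverseʳ (dilate 2 ψExponent b)) ⟩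
      run-at podExponent (run-at (λ _ → + 0) 1ˢ)
        ≈⟨ Linear.cong-≗ (run-linear (eta N podExponent)) (eta-0 N 1ˢ) ⟩
      run-at podExponent 1ˢ
        ≈⟨ signedPod-eta N ⟨
      signedPod N ∎
      where open ≗-Reasoning

  shift-1ˢ : ∀ x N → shift x 1ˢ N ≡ + indicator x N
  shift-1ˢ zero    zero    = refl
  shift-1ˢ zero    (suc N) = refl
  shift-1ˢ (suc x) zero    = refl
  shift-1ˢ (suc x) (suc N) = shift-1ˢ x N

  ∑ˢ-coefficient : ∀ K F N {g} → (∀ j → F j N ≡ + g j) → ∑ˢ K F N ≡ + ∑ K g
  ∑ˢ-coefficient zero    F N F≡g = refl
  ∑ˢ-coefficient (suc K) F N F≡g = cong₂ _+_ (∑ˢ-coefficient K F N F≡g) (F≡g K)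

  ψ²-coefficient : ∀ K N → (ψ K ⋆ ψ K) N ≡ + count K N
  ψ²-coefficient K N = begin
    (ψ K ⋆ ψ K) N
      ≡⟨ Linear-properties.∑ˢ-hom (⋆-linear (ψ K)) K (λ a → shift (tri a) 1ˢ) N ⟩
    ∑ˢ K (λ a → shift (tri a) 1ˢ ⋆ ψ K) N
      ≡⟨ ∑ˢ-cong K (λ a → ≗.trans (Linear.shift-hom (⋆-linear (ψ K)) (tri a) 1ˢ)
          (shift-cong (tri a) (⋆-identityˡ (ψ K)))) N ⟩
    ∑ˢ K (λ a → shift (tri a) (ψ K)) N
      ≡⟨ ∑ˢ-cong K (λ a → Linear-properties.∑ˢ-hom (shift-linear (tri a)) K _) N ⟩
    ∑ˢ K (λ a → ∑ˢ K λ b → shift (tri a) (shift (tri b) 1ˢ)) N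
      ≡⟨ ∑ˢ-coefficient K _ N (λ a → ∑ˢ-coefficient K _ N λ b →
          trans (shift-+ (tri a) (tri b) 1ˢ N) (shift-1ˢ (tri a ℕ.+ tri b) N)) ⟩
    + count K N ∎
    where open ≡-Reasoning

  pod₃≡count : ∀ N C → N ℕ.< C → + 3 ∣ signed N (+ pod₃ N) - + count C N
  pod₃≡count N (suc n′) (s≤s N≤n′) =
    subst (λ c → + 3 ∣ signed N (+ pod₃ N) - c) (ψ²-coefficient (suc n′) N) (_≡_[mod_]≤_.get (signedPod≡ψ² N n′ N≤n′) N ℕP.≤-refl)

  ∣-signed : ∀ {d} n z → d ∣ signed n z → d ∣ z
  ∣-signed zero    z d∣z  = d∣z
  ∣-signed (suc n) z d∣-z = ∣-signed n z (subst (_ ∣_) (ℤP.neg-involutive (signed n z)) (∣m⇒∣-m d∣-z))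

  private
    ∣⊖⇒%≡ : ∀ {n} .{{_ : ℕ.NonZero n}} {a b} → b ℕ.≤ a → + n ∣ a ℤ.⊖ b → a % n ≡ b % n
    ∣⊖⇒%≡ {n} {a} {b} b≤a n∣a⊖b = begin
      a % n                   ≡⟨ cong (_% n) (ℕP.m∸n+n≡m b≤a) ⟨
      (a ℕ.∸ b ℕ.+ b) % n     ≡⟨ %-remove-+ˡ b (∣⇒∣ᵤ (subst (+ n ∣_) (ℤP.⊖-≥ b≤a) n∣a⊖b)) ⟩
      b % n                   ∎
      where open ≡-Reasoning

  ∣-difference⇒%≡ : ∀ {n} .{{_ : ℕ.NonZero n}} a b → + n ∣ + a - + b → a % n ≡ b % n
  ∣-difference⇒%≡ a b n∣a-b with ℕP.≤-total b a | subst (_ ∣_) (ℤP.m-n≡m⊖n a b) n∣a-b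
  ... | inj₁ b≤a | n∣a⊖b = ∣⊖⇒%≡ b≤a n∣a⊖b
  ... | inj₂ a≤b | n∣a⊖b = sym (∣⊖⇒%≡ a≤b (subst (_ ∣_) (sym (ℤP.⊖-swap b a)) (∣m⇒∣-m n∣a⊖b)))

  pod₃-≡-from-count : ∀ {N₁ N₂ C₁ C₂} → N₁ ℕ.< C₁ → N₂ ℕ.< C₂ → N₁ % 2 ≡ N₂ % 2 →
                      count C₁ N₁ ≡ count C₂ N₂ → pod₃ N₁ % 3 ≡ pod₃ N₂ % 3
  pod₃-≡-from-count {N₁} {N₂} {C₁} {C₂} N₁<C₁ N₂<C₂ parity counts =
    ∣-difference⇒%≡ (pod₃ N₁) (pod₃ N₂)
      (∣-signed N₂ _ (subst (+ 3 ∣_) difference (∣m∣n⇒∣m-n (pod₃≡count N₁ C₁ N₁<C₁) (pod₃≡count N₂ C₂ N₂<C₂))))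
    where
    P₁ = + pod₃ N₁
    P₂ = + pod₃ N₂
    same-sign : signed N₁ P₁ ≡ signed N₂ P₁
    same-sign = trans (signed-%2 N₁ P₁) (trans (cong (λ x → signed x P₁) parity) (sym (signed-%2 N₂ P₁)))
    difference : (signed N₁ P₁ - + count C₁ N₁) - (signed N₂ P₂ - + count C₂ N₂) ≡ signed N₂ (P₁ - P₂)
    difference = begin
      (signed N₁ P₁ - + count C₁ N₁) - (signed N₂ P₂ - + count C₂ N₂)
        ≡⟨ cong₂ (λ x c → (x - + c) - (signed N₂ P₂ - + count C₂ N₂)) same-sign counts ⟩
      (signed N₂ P₁ - + count C₂ N₂) - (signed N₂ P₂ - + count C₂ N₂)
        ≡⟨ cancel (signed N₂ P₁) (signed N₂ P₂) (+ count C₂ N₂) ⟩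
      signed N₂ P₁ - signed N₂ P₂
        ≡⟨ cong (_+_ (signed N₂ P₁)) (signed-neg N₂ P₂) ⟨
      signed N₂ P₁ + signed N₂ (- P₂)
        ≡⟨ signed-+ N₂ P₁ (- P₂) ⟨
      signed N₂ (P₁ - P₂)
        ∎
      where
      open ≡-Reasoning
      cancel : ∀ (x y c : ℤ) → (x - c) - (y - c) ≡ x - y
      cancel = solve-∀

module SumsOfTwoSquares where

  open import Data.Nat
  open import Data.Nat.Properties
  open import Data.Nat.Combinatorics using (_C_; nC1≡n; nCk+nC[k+1]≡[n+1]C[k+1]; nCn≡1)
  open import Data.Nat.DivMod using (m≡m%n+[m/n]*n)
  open import Data.Nat.Divisibility using (_∣_; divides; ∣⇒≤; m∣m*n; ∣m⇒∣m*n; ∣m∣n⇒∣m+n; ∣m+n∣m⇒∣n; ∣n⇒∣m*n; ∣-trans; 1∣_; _∣?_)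
  open import Data.Nat.Primality using (Prime; euclidsLemma)
  open import Data.Nat.Tactic.RingSolver using (solve-∀)
  open import Data.Fin using (Fin; toℕ; zero; suc; fromℕ; inject₁)
  open import Data.Fin.Properties using (toℕ-fromℕ; toℕ-inject₁; toℕ<n)
  import Algebra.Properties.CommutativeSemiring.Binomial +-*-commutativeSemiring as Binomial
  import Algebra.Properties.Semiring.Exp +-*-semiring as Exp
  open import Algebra.Properties.Semiring.Mult +-*-semiring using (_×_)
  open import Algebra.Properties.Semiring.Sum +-*-semiring using (sum; sum-init-last; sum-cong-≗)
  open import Data.Product using (∃-syntax; _,_)
  open import Data.Sum using (inj₁; inj₂)
  open import Relation.Nullary using (¬_; yes; no; contradiction)
  open import Relation.Binary.PropositionalEquality

  private
    ×≡* : ∀ n x → n × x ≡ n * x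
    ×≡* zero    x = refl
    ×≡* (suc n) x = cong (x +_) (×≡* n x)

    ^≡^ : ∀ x n → x Exp.^ n ≡ x ^ n
    ^≡^ x zero    = refl
    ^≡^ x (suc n) = cong (x *_) (^≡^ x n)

  binomial-theorem : ∀ n x → (x + 1) ^ n ≡ sum λ (k : Fin (suc n)) → (n C toℕ k) * x ^ toℕ k
  binomial-theorem n x = begin
    (x + 1) ^ n                 ≡⟨ ^≡^ (x + 1) n ⟨
    (x + 1) Exp.^ n             ≡⟨ Binomial.theorem n x 1 ⟩
    Binomial.binomialExpansion x 1 n ≡⟨ sum-cong-≗ {suc n} term ⟩
    sum {suc n} (λ k → (n C toℕ k) * x ^ toℕ k) ∎
    where
    open ≡-Reasoning
    term : ∀ (k : Fin (suc n)) → Binomial.binomialTerm x 1 n k ≡ (n C toℕ k) * x ^ toℕ k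
    term k = trans (×≡* (n C toℕ k) _) (cong ((n C toℕ k) *_)
      (trans (cong₂ _*_ (^≡^ x (toℕ k)) (trans (^≡^ 1 (n ∸ toℕ k)) (^-zeroˡ (n ∸ toℕ k)))) (*-identityʳ (x ^ toℕ k))))

  absorption : ∀ n k → suc k * (suc n C suc k) ≡ suc n * (n C k)
  absorption zero    zero    = refl
  absorption zero    (suc k) = *-zeroʳ (suc (suc k))
  absorption (suc n) zero    = trans (*-identityˡ (suc (suc n) C 1)) (trans (nC1≡n (suc (suc n))) (sym (*-identityʳ (suc (suc n)))))
  absorption (suc n) (suc k) = begin
    suc (suc k) * (suc (suc n) C suc (suc k))
      ≡⟨ cong (suc (suc k) *_) (nCk+nC[k+1]≡[n+1]C[k+1] (suc n) (suc k)) ⟨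
    suc (suc k) * (a + b)
      ≡⟨ expand (suc k) a b ⟩
    suc k * a + a + suc (suc k) * b
      ≡⟨ cong₂ (λ u v → u + a + v) (absorption n k) (absorption n (suc k)) ⟩
    suc n * (n C k) + a + suc n * (n C suc k)
      ≡⟨ collect (suc n) (n C k) (n C suc k) a ⟩
    suc n * (n C k + n C suc k) + a
      ≡⟨ cong (λ c → suc n * c + a) (nCk+nC[k+1]≡[n+1]C[k+1] n k) ⟩
    suc n * a + a
      ≡⟨ +-comm (suc n * a) a ⟩
    suc (suc n) * a ∎
    where
    open ≡-Reasoning
    a = suc n C suc k
    b = suc n C suc (suc k)
    expand : ∀ k a b → suc k * (a + b) ≡ k * a + a + suc k * b
    expand = solve-∀
    collect : ∀ m c d a → m * c + a + m * d ≡ m * (c + d) + a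
    collect = solve-∀

  prime∣binomial : ∀ {p} → Prime p → ∀ k → suc k < p → p ∣ p C suc k
  prime∣binomial {suc p′} p-prime k 1+k<p with euclidsLemma (suc k) (suc p′ C suc k) p-prime
                                                   (subst (suc p′ ∣_) (sym (absorption p′ k)) (m∣m*n (p′ C k)))
  ... | inj₁ p∣1+k = contradiction (∣⇒≤ p∣1+k) (<⇒≱ 1+k<p)
  ... | inj₂ p∣C   = p∣C

  ∣-sum : ∀ {d n} (t : Fin n → ℕ) → (∀ i → d ∣ t i) → d ∣ sum t
  ∣-sum {n = zero}  t d∣t = divides 0 refl
  ∣-sum {n = suc n} t d∣t = ∣m∣n⇒∣m+n (d∣t zero) (∣-sum (λ i → t (suc i)) (λ i → d∣t (suc i)))

  module _ {p′ : ℕ} (p-prime : Prime (suc p′)) where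
    private
      p : ℕ
      p = suc p′

      inject₁<p′ : ∀ (i : Fin p′) → toℕ (inject₁ i) < p′
      inject₁<p′ i = subst (_< p′) (sym (toℕ-inject₁ i)) (toℕ<n i)

    freshman : ∀ x → ∃[ d ] (x + 1) ^ p ≡ 1 + d * p + x ^ p
    freshman x with ∣-sum (λ (i : Fin p′) → (p C suc (toℕ (inject₁ i))) * x ^ suc (toℕ (inject₁ i)))
                          (λ i → ∣m⇒∣m*n _ (prime∣binomial p-prime (toℕ (inject₁ i)) (s≤s (inject₁<p′ i))))
    ... | divides d middle = d , (begin
      (x + 1) ^ p                                ≡⟨ binomial-theorem p x ⟩
      1 + sum (λ i → t (suc i))                  ≡⟨ cong (1 +_) (sum-init-last (λ i → t (suc i))) ⟩
      1 + (sum (λ i → t (suc (inject₁ i))) + t (suc (fromℕ p′)))  ≡⟨ cong₂ (λ u v → 1 + (u + v)) middle last ⟩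
      1 + (d * p + x ^ p)                        ≡⟨ +-assoc 1 (d * p) (x ^ p) ⟨
      1 + d * p + x ^ p                          ∎)
      where
      open ≡-Reasoning
      t : Fin (suc p) → ℕ
      t k = (p C toℕ k) * x ^ toℕ k
      last : t (suc (fromℕ p′)) ≡ x ^ p
      last rewrite toℕ-fromℕ p′ = trans (cong (_* x ^ p) (nCn≡1 p)) (*-identityˡ (x ^ p))

    fermat : ∀ x → ∃[ q ] x ^ p ≡ x + q * p
    fermat zero    = 0 , refl
    fermat (suc x) with freshman x | fermat x
    ... | d , step | q , IH = d + q , (begin
      suc x ^ p                      ≡⟨ cong (_^ p) (+-comm 1 x) ⟩
      (x + 1) ^ p                    ≡⟨ step ⟩
      1 + d * p + x ^ p              ≡⟨ cong (1 + d * p +_) IH ⟩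
      1 + d * p + (x + q * p)        ≡⟨ collect x d q p ⟩
      suc x + (d + q) * p            ∎)
      where
      open ≡-Reasoning
      collect : ∀ x d q p → 1 + d * p + (x + q * p) ≡ suc x + (d + q) * p
      collect = solve-∀

    fermat-unit : ∀ x → ¬ p ∣ x → p ∣ x ^ p′ ∸ 1
    fermat-unit zero    p∤0 = contradiction (divides 0 refl) p∤0
    fermat-unit (suc x) p∤x with fermat (suc x)
    ... | q , eq with euclidsLemma (suc x) (suc x ^ p′ ∸ 1) p-prime (divides q factored)
      where
      factored : suc x * (suc x ^ p′ ∸ 1) ≡ q * p
      factored = trans (*-distribˡ-∸ (suc x) (suc x ^ p′) 1)
                       (trans (cong₂ _∸_ eq (*-identityʳ (suc x))) (m+n∸m≡n (suc x) (q * p)))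
    ... | inj₁ p∣x = contradiction p∣x p∤x
    ... | inj₂ p∣  = p∣

  odd-power-sum : ∀ A B q → A + B ∣ A ^ suc (q * 2) + B ^ suc (q * 2)
  odd-power-sum A B zero    = divides 1 (solve A B)
    where
    solve : ∀ A B → A * 1 + B * 1 ≡ 1 * (A + B)
    solve = solve-∀
  odd-power-sum A B (suc q) = ∣m+n∣m⇒∣n (subst (A + B ∣_) (sym (recurrence A B (A ^ h) (B ^ h))) (m∣m*n _))
                                         (∣n⇒∣m*n (A * B) (odd-power-sum A B q))
    where
    h = suc (q * 2)
    recurrence : ∀ A B a b → A * B * (a + b) + (A * (A * a) + B * (B * b)) ≡ (A + B) * (A * a + B * b)
    recurrence = solve-∀

  module _ {p′ : ℕ} (p-prime : Prime (suc p′)) (p≡3 : suc p′ % 4 ≡ 3) where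
    private
      p h : ℕ
      p = suc p′
      h = suc (p / 4 * 2)

      p′≡2h : p′ ≡ 2 * h
      p′≡2h = suc-injective (trans (trans (m≡m%n+[m/n]*n p 4) (cong (_+ p / 4 * 4) p≡3)) (solve (p / 4)))
        where
        solve : ∀ q → 3 + q * 4 ≡ suc (2 * suc (q * 2))
        solve = solve-∀

      2<p : 2 < p
      2<p = subst (2 <_) (sym (m≡m%n+[m/n]*n p 4)) (subst (λ r → 2 < r + p / 4 * 4) (sym p≡3) (s≤s (s≤s (s≤s z≤n))))

      square-power : ∀ z → z ^ p′ ≡ (z * z) ^ h
      square-power z = trans (cong (z ^_) p′≡2h) (sym (trans (cong (λ w → (z * w) ^ h) (sym (*-identityʳ z))) (^-*-assoc z 2 h)))

      unit-power : ∀ z → ¬ p ∣ z → z ^ p′ ≡ (z ^ p′ ∸ 1) + 1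
      unit-power zero    p∤0 = contradiction (divides 0 refl) p∤0
      unit-power (suc z) _   = sym (m∸n+n≡m (m^n>0 (suc z) p′))

    -- Otherwise -1 ≡ (y/x)² would be a square modulo p ≡ 3 (mod 4).
    prime∣sum-of-squares : ∀ x y → p ∣ x * x + y * y → p ∣ x
    prime∣sum-of-squares x y p∣sum with p ∣? x
    ... | yes p∣x = p∣x
    ... | no  p∤x = contradiction (∣⇒≤ p∣2) (<⇒≱ 2<p)
      where
      p∤y : ¬ p ∣ y
      p∤y p∣y with euclidsLemma x x p-prime (∣m+n∣m⇒∣n (subst (p ∣_) (+-comm (x * x) (y * y)) p∣sum) (∣m⇒∣m*n y p∣y))
      ... | inj₁ p∣x = p∤x p∣x
      ... | inj₂ p∣x = p∤x p∣x
      p∣powers : p ∣ x ^ p′ + y ^ p′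
      p∣powers = subst (p ∣_) (sym (cong₂ _+_ (square-power x) (square-power y)))
                       (∣-trans p∣sum (odd-power-sum (x * x) (y * y) (p / 4)))
      p∣2 : p ∣ 2
      p∣2 = ∣m+n∣m⇒∣n (subst (p ∣_) powers-minus-1 p∣powers) (∣m∣n⇒∣m+n (fermat-unit p-prime x p∤x) (fermat-unit p-prime y p∤y))
        where
        regroup : ∀ a b → (a + 1) + (b + 1) ≡ (a + b) + 2
        regroup = solve-∀
        powers-minus-1 : x ^ p′ + y ^ p′ ≡ (x ^ p′ ∸ 1 + (y ^ p′ ∸ 1)) + 2
        powers-minus-1 = trans (cong₂ _+_ (unit-power x p∤x) (unit-power y p∤y)) (regroup (x ^ p′ ∸ 1) (y ^ p′ ∸ 1))

    prime-power∣sum-of-squares : ∀ j x y Z → x * x + y * y ≡ (p ^ j * p ^ j) * Z → p ^ j ∣ x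
    prime-power∣sum-of-squares zero    x y Z _  = 1∣ x
    prime-power∣sum-of-squares (suc j) x y Z eq
      with prime∣sum-of-squares x y p∣sum | prime∣sum-of-squares y x (subst (p ∣_) (+-comm (x * x) (y * y)) p∣sum)
      where
      p∣sum : p ∣ x * x + y * y
      p∣sum = divides (p ^ j * (p * p ^ j) * Z) (trans eq (solve p (p ^ j) Z))
        where
        solve : ∀ p P Z → (p * P * (p * P)) * Z ≡ (P * (p * P) * Z) * p
        solve = solve-∀
    ... | divides x′ refl | divides y′ refl with prime-power∣sum-of-squares j x′ y′ Z (*-cancelʳ-≡ _ _ (p * p) reduced)
      where
      reduced : (x′ * x′ + y′ * y′) * (p * p) ≡ (p ^ j * p ^ j * Z) * (p * p)
      reduced = trans (solve₁ x′ y′ p) (trans eq (solve₂ p (p ^ j) Z))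
        where
        solve₁ : ∀ x′ y′ p → (x′ * x′ + y′ * y′) * (p * p) ≡ x′ * p * (x′ * p) + y′ * p * (y′ * p)
        solve₁ = solve-∀
        solve₂ : ∀ p P Z → (p * P * (p * P)) * Z ≡ (P * P * Z) * (p * p)
        solve₂ = solve-∀
    ... | divides c refl = divides c (solve c (p ^ j) p)
      where
      solve : ∀ c P p → c * P * p ≡ c * (p * P)
      solve = solve-∀

open import Defs
open TripleProduct using (tri)
open Counting using (count; count-regroup)
open SumsOfTwoSquares using (prime-power∣sum-of-squares)
open import Data.Nat
open import Data.Nat.Properties
open import Data.Nat.DivMod using (m≡m%n+[m/n]*n; m*n/n≡m; [m+kn]%n≡m%n)
open import Data.Nat.Divisibility using (_∣_; divides; ∣m+n∣m⇒∣n; ∣n⇒∣m*n; ∣-refl)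
open import Data.Nat.Primality using (Prime)
open import Data.Nat.Tactic.RingSolver using (solve-∀)
open import Data.Product using (∃-syntax; _,_)
open import Relation.Nullary using (contradiction)
open import Relation.Binary.PropositionalEquality
open Pod using (pod₃-≡-from-count)

odd : ℕ → ℕ
odd a = suc (a * 2)

tri-double : ∀ a → tri a * 2 ≡ a * suc a
tri-double zero    = refl
tri-double (suc a) = begin
  (suc a + tri a) * 2        ≡⟨ *-distribʳ-+ 2 (suc a) (tri a) ⟩
  suc a * 2 + tri a * 2      ≡⟨ cong (suc a * 2 +_) (tri-double a) ⟩
  suc a * 2 + a * suc a      ≡⟨ solve a ⟩
  suc a * suc (suc a)        ∎
  where
  open ≡-Reasoning
  solve : ∀ a → suc a * 2 + a * suc a ≡ suc a * suc (suc a)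
  solve = solve-∀

odd-square : ∀ a → odd a * odd a ≡ suc (tri a * 8)
odd-square a = begin
  odd a * odd a             ≡⟨ solve₁ a ⟩
  suc (a * suc a * 4)       ≡⟨ cong (λ x → suc (x * 4)) (tri-double a) ⟨
  suc (tri a * 2 * 4)       ≡⟨ cong suc (solve₂ (tri a)) ⟩
  suc (tri a * 8)           ∎
  where
  open ≡-Reasoning
  solve₁ : ∀ a → suc (a * 2) * suc (a * 2) ≡ suc (a * suc a * 4)
  solve₁ = solve-∀
  solve₂ : ∀ t → t * 2 * 4 ≡ t * 8
  solve₂ = solve-∀

odd-squares : ∀ a b → odd a * odd a + odd b * odd b ≡ suc (suc ((tri a + tri b) * 8))
odd-squares a b = trans (cong₂ _+_ (odd-square a) (odd-square b)) (solve (tri a) (tri b))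
  where
  solve : ∀ x y → suc (x * 8) + suc (y * 8) ≡ suc (suc ((x + y) * 8))
  solve = solve-∀

tri-sum⇒odd-squares : ∀ a b {N} → tri a + tri b ≡ N → odd a * odd a + odd b * odd b ≡ suc (suc (N * 8))
tri-sum⇒odd-squares a b refl = odd-squares a b

odd-squares⇒tri-sum : ∀ a b {N} → odd a * odd a + odd b * odd b ≡ suc (suc (N * 8)) → tri a + tri b ≡ N
odd-squares⇒tri-sum a b {N} eq = *-cancelʳ-≡ (tri a + tri b) N 8 (suc-injective (suc-injective (trans (sym (odd-squares a b)) eq)))

private
  multiple-below-double : ∀ {m x} → m ∣ x → 0 < x → x < 2 * m → x ≡ m
  multiple-below-double {m} (divides zero          refl) 0<0   _    = contradiction 0<0 (<-irrefl refl)
  multiple-below-double {m} (divides (suc zero)    refl) _     _    = +-identityʳ m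
  multiple-below-double {m} (divides (suc (suc u)) refl) _     x<2m =
    contradiction x<2m (≤⇒≯ (*-monoˡ-≤ m (s≤s (s≤s (z≤n {u})))))

module _ (r₀ : ℕ) (m∣ : ∀ x y Z → x * x + y * y ≡ odd r₀ * odd r₀ * Z → odd r₀ ∣ x) where
  private
    m t : ℕ
    m = odd r₀
    t = tri r₀

    odd-scaled : ∀ c → odd (r₀ + c * m) ≡ m * odd c
    odd-scaled c = solve r₀ c
      where
      solve : ∀ r₀ c → suc ((r₀ + c * suc (r₀ * 2)) * 2) ≡ suc (r₀ * 2) * suc (c * 2)
      solve = solve-∀

    m≢0 : m * m ≢ 0
    m≢0 ()

  module _ (N₂ : ℕ) where
    private
      N₁ Z : ℕ
      N₁ = m * m * N₂ + t * 2
      Z = suc (suc (N₂ * 8))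

      scaled : suc (suc (N₁ * 8)) ≡ m * m * Z
      scaled = trans (cong (λ s → suc (suc ((s * N₂ + t * 2) * 8))) (odd-square r₀))
                     (trans (solve t N₂) (cong (_* Z) (sym (odd-square r₀))))
        where
        solve : ∀ t N₂ → suc (suc ((suc (t * 8) * N₂ + t * 2) * 8)) ≡ suc (t * 8) * suc (suc (N₂ * 8))
        solve = solve-∀

      residue : ∀ r c b → r < m → tri (r + c * m) + tri b ≡ N₁ → r ≡ r₀
      residue r c b r<m eq = *-cancelʳ-≡ r r₀ 2 (suc-injective (multiple-below-double m∣odd-r (s≤s z≤n) odd-r<2m))
        where
        m∣odd-r : m ∣ odd r
        m∣odd-r = ∣m+n∣m⇒∣n (subst (m ∣_) (solve r c m) (m∣ (odd (r + c * m)) (odd b) Z squares)) (∣n⇒∣m*n (c * 2) ∣-refl)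
          where
          squares = trans (tri-sum⇒odd-squares (r + c * m) b eq) scaled
          solve : ∀ r c k → suc ((r + c * k) * 2) ≡ c * 2 * k + suc (r * 2)
          solve = solve-∀
        odd-r<2m : odd r < 2 * m
        odd-r<2m = subst (_≤ 2 * m) (solve r) (*-monoʳ-≤ 2 r<m)
          where
          solve : ∀ r → 2 * suc r ≡ suc (suc (r * 2))
          solve = solve-∀

      squares-scaled : ∀ c d → odd (r₀ + c * m) * odd (r₀ + c * m) + odd (r₀ + d * m) * odd (r₀ + d * m)
                             ≡ m * m * (odd c * odd c + odd d * odd d)
      squares-scaled c d = trans (cong₂ (λ u v → u * u + v * v) (odd-scaled c) (odd-scaled d)) (solve m (odd c) (odd d))
        where
        solve : ∀ k x y → k * x * (k * x) + k * y * (k * y) ≡ k * k * (x * x + y * y)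
        solve = solve-∀

      scale⇒ : ∀ c d → tri (r₀ + c * m) + tri (r₀ + d * m) ≡ N₁ → tri c + tri d ≡ N₂
      scale⇒ c d eq = odd-squares⇒tri-sum c d (*-cancelˡ-≡ _ _ (m * m) {{≢-nonZero m≢0}}
        (trans (sym (squares-scaled c d)) (trans (tri-sum⇒odd-squares (r₀ + c * m) (r₀ + d * m) eq) scaled)))

      scale⇐ : ∀ c d → tri c + tri d ≡ N₂ → tri (r₀ + c * m) + tri (r₀ + d * m) ≡ N₁
      scale⇐ c d eq = odd-squares⇒tri-sum (r₀ + c * m) (r₀ + d * m)
        (trans (squares-scaled c d) (trans (cong (m * m *_) (tri-sum⇒odd-squares c d eq)) (sym scaled)))

    count-scaling : ∀ C → count (C * m) N₁ ≡ count C N₂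
    count-scaling = count-regroup (s≤s (m≤m*n r₀ 2)) residue scale⇒ scale⇐

    same-parity : N₁ % 2 ≡ N₂ % 2
    same-parity = trans (cong (_% 2) (trans (cong (λ s → s * N₂ + t * 2) (odd-square r₀)) (regroup t N₂)))
                        ([m+kn]%n≡m%n N₂ (t * 4 * N₂ + t) 2)
      where
      regroup : ∀ t N₂ → suc (t * 8) * N₂ + t * 2 ≡ N₂ + (t * 4 * N₂ + t) * 2
      regroup = solve-∀

    pod₃-scaling : pod₃ N₁ % 3 ≡ pod₃ N₂ % 3
    pod₃-scaling =
      pod₃-≡-from-count (<-≤-trans (n<1+n N₁) (m≤m*n (suc N₁) m)) (s≤s N₂≤N₁) same-parity (count-scaling (suc N₁))
      where
      N₂≤N₁ : N₂ ≤ N₁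
      N₂≤N₁ = ≤-trans (m≤n*m N₂ (m * m)) (m≤m+n (m * m * N₂) (t * 2))

odd-power : ∀ a j → ∃[ r ] odd a ^ j ≡ odd r
odd-power a zero    = 0 , refl
odd-power a (suc j) with odd-power a j
... | r , eq = a + r + a * r * 2 , trans (cong (odd a *_) eq) (solve a r)
  where
  solve : ∀ a r → suc (a * 2) * suc (r * 2) ≡ suc ((a + r + a * r * 2) * 2)
  solve = solve-∀

3-mod-4-power : ∀ {p} → p % 4 ≡ 3 → ∀ j → ∃[ r ] p ^ j ≡ odd r
3-mod-4-power {p} p≡3 j with odd-power (suc (p / 4 * 2)) j
... | r , eq = r , trans (cong (_^ j) p-odd) eq
  where
  p-odd : p ≡ odd (suc (p / 4 * 2))
  p-odd = trans (m≡m%n+[m/n]*n p 4) (trans (cong (_+ p / 4 * 4) p≡3) (solve (p / 4)))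
    where
    solve : ∀ q → 3 + q * 4 ≡ suc (suc (q * 2) * 2)
    solve = solve-∀

-- With m = p^(k+1) = 2r₀+1, and so m² = 8T(r₀) + 1, the argument N of the theorem is m² · np + 2T(r₀).
index-identity : ∀ p k n r₀ → p ^ suc k ≡ odd r₀ →
                 p ^ (2 * suc k + 1) * n + (p ^ (2 * suc k) ∸ 1) / 4 ≡ odd r₀ * odd r₀ * (n * p) + tri r₀ * 2
index-identity p k n r₀ p^k+1≡m = cong₂ _+_
  (trans (cong (_* n) (trans (^-distribˡ-+-* p (2 * suc k) 1) (cong (_* p ^ 1) p^2k+2≡m²))) (regroup (m * m) p n))
  (trans (cong (λ w → (w ∸ 1) / 4) (trans p^2k+2≡m² (odd-square r₀)))
         (trans (cong (_/ 4) (eight (tri r₀))) (m*n/n≡m (tri r₀ * 2) 4)))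
  where
  m = odd r₀
  p^2k+2≡m² : p ^ (2 * suc k) ≡ m * m
  p^2k+2≡m² = trans (^-distribˡ-+-* p (suc k) (suc k + 0))
                    (cong₂ _*_ p^k+1≡m (trans (cong (p ^_) (+-identityʳ (suc k))) p^k+1≡m))
  regroup : ∀ s p n → s * (p * 1) * n ≡ s * (n * p)
  regroup = solve-∀
  eight : ∀ t → t * 8 ≡ t * 2 * 4
  eight = solve-∀

corollary3 : (k : ℕ) → (p : ℕ) → Prime p → p % 4 ≡ 3 → (n : ℕ) →
    pod₃ (p ^ (2 * suc k + 1) * n + (p ^ (2 * suc k) ∸ 1) / 4) % 3 ≡ pod₃ (n * p) % 3
corollary3 k zero     _       ()
corollary3 k (suc p′) p-prime p≡3 n with 3-mod-4-power p≡3 (suc k)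
... | r₀ , p^k+1≡m =
  subst (λ N → pod₃ N % 3 ≡ pod₃ (n * suc p′) % 3) (sym (index-identity (suc p′) k n r₀ p^k+1≡m))
        (pod₃-scaling r₀ m∣ (n * suc p′))
  where
  m∣ : ∀ x y Z → x * x + y * y ≡ odd r₀ * odd r₀ * Z → odd r₀ ∣ x
  m∣ x y Z eq = subst (_∣ x) p^k+1≡m (prime-power∣sum-of-squares p-prime p≡3 (suc k) x y Z
                  (trans eq (cong (λ w → w * w * Z) (sym p^k+1≡m))))
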